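{- Let $q$ be a prime power, $M$ a subgroup of $\mathbb F_q^*$ with $m$ elements, and $n\ge1$. Then in the group ring $\mathbb Z[\mathrm{SL}_2(\mathbb F_q)]$, $$\left(\sum_{\mu\in M}\sum_{x\in\mathbb F_q}\left[\begin{pmatrix}x&\mu\\-1/\mu&0\end{pmatrix}\right]\right)^n=m^n\sum_{\begin{pmatrix}a&b\\c&d\end{pmatrix}\in\mathrm{SL}_2(\mathbb F_q)}\kappa_n(b,d)\left[\begin{pmatrix}a&b\\c&d\end{pmatrix}\right],$$ where $\kappa_n(b,d)$ is defined below.
   Context: Put $\epsilon(n)=1$ if $n$ is even and $0$ if $n$ is odd, and $k(n)=\lfloor (n-1)/2\rfloor$. Define $\beta_n=q^{\epsilon(n)}\frac{q^{2k(n)}-1}{q^2-1}$, $\alpha_n=\beta_n-\frac{q^{k(n)}-1}{q-1}$, $\gamma_n=\alpha_n+\frac{q^{k(n)}}{m}$. If $-1\in M$ put $\overline M=\mathbb F_q^*\setminus M$; if $-1\notin M$ put $\overline M=\mathbb F_q^*\setminus(M\cup -M)$. For a nonzero $(b,d)\in\mathbb F_q^2$ define $\kappa_n(b,d)$ as follows. Case $-1\in M$: if $d=0,b\in M$: $\beta_n$ ($n$ even), $\gamma_n$ ($n$ odd); if $d=0,b\in\overline M$: $\beta_n$ ($n$ even), $\alpha_n$ ($n$ odd); if $d\in M$: $\gamma_n$ ($n$ even), $\beta_n$ ($n$ odd); if $d\in\overline M$: $\alpha_n$ ($n$ even), $\beta_n$ ($n$ odd). Case $-1\notin M$ (values listed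 for $n\equiv0,1,2,3\pmod 4$): if $d=0,b\in M$: $\beta_n,\gamma_n,\beta_n,\alpha_n$; if $d=0,b\in -M$: $\beta_n,\alpha_n,\beta_n,\gamma_n$; if $d=0,b\in\overline M$: $\beta_n,\alpha_n,\beta_n,\alpha_n$; if $d\in M$: $\gamma_n,\beta_n,\alpha_n,\beta_n$; if $d\in -M$: $\alpha_n,\beta_n,\gamma_n,\beta_n$; if $d\in\overline M$: $\alpha_n,\beta_n,\alpha_n,\beta_n$. (Every element of $\mathrm{SL}_2$ has $(b,d)\neq(0,0)$.) -}

module Defs where

open import Level using (0ℓ)
open import Data.Bool using (Bool; true; false; _∧_; if_then_else_)
open import Data.Nat as ℕ using (ℕ; zero; suc; _∸_; ⌊_/2⌋)
open import Data.Integer as ℤ using (ℤ; +_; _+_; _*_; _-_)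
open import Data.List using (List; []; _∷_; foldr; length; filter; concatMap; map)
open import Data.List.Relation.Unary.Unique.Propositional using (Unique)
open import Data.List.Membership.Propositional using (_∈_)
open import Data.Empty using (⊥)
open import Relation.Nullary using (¬_; Dec; yes; no)
open import Relation.Nullary.Decidable using (⌊_⌋)
open import Relation.Unary using (Pred; Decidable)
open import Relation.Binary.PropositionalEquality using (_≡_)
open import Relation.Binary.Definitions using (DecidableEquality)
open import Algebra.Structures using (IsCommutativeRing)

-- A finite field F_q: a commutative ring (with propositional equality)
-- in which 0 ≠ 1 and every nonzero element is invertible, with decidable
-- equality and an explicit duplicate-free exhaustive enumeration.
-- q is the number of elements (automatically a prime power).

record FiniteField : Set₁ where
  infixl 7 _·_
  infixl 6 _⊕_
  field
    Carrier  : Set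
    _⊕_ _·_  : Carrier → Carrier → Carrier
    ⊝_       : Carrier → Carrier
    𝟘 𝟙      : Carrier
    isCommutativeRing : IsCommutativeRing _≡_ _⊕_ _·_ ⊝_ 𝟘 𝟙
    𝟘≢𝟙      : ¬ (𝟘 ≡ 𝟙)
    _⁻¹      : Carrier → Carrier
    ⁻¹-inverse : ∀ x → ¬ (x ≡ 𝟘) → x · (x ⁻¹) ≡ 𝟙
    _≟_      : DecidableEquality Carrier
    elems    : List Carrier
    elems-unique   : Unique elems
    elems-complete : ∀ x → x ∈ elems

  q : ℕ
  q = length elems

record Subgroup (F : FiniteField) : Set₁ where
  open FiniteField F
  field
    Mem      : Pred Carrier 0ℓ
    Mem?     : Decidable Mem
    nonzero  : ∀ {x} → Mem x → ¬ (x ≡ 𝟘)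
    one      : Mem 𝟙
    mul      : ∀ {x y} → Mem x → Mem y → Mem (x · y)
    inv      : ∀ {x} → Mem x → Mem (x ⁻¹)

  -- the list of elements of M (without repetition, as elems has none)
  elemsM : List Carrier
  elemsM = filter Mem? elems

  m : ℕ
  m = length elemsM

module _ (F : FiniteField) where
  open FiniteField F

  record Mat : Set where
    constructor mat
    field a b c d : Carrier

  det : Mat → Carrier
  det (mat a b c d) = (a · d) ⊕ (⊝ (b · c))

  _⊗_ : Mat → Mat → Mat
  mat a b c d ⊗ mat a' b' c' d' =
    mat ((a · a') ⊕ (b · c')) ((a · b') ⊕ (b · d'))
        ((c · a') ⊕ (d · c')) ((c · b') ⊕ (d · d'))

  idMat : Mat
  idMat = mat 𝟙 𝟘 𝟘 𝟙

  _==_ : Mat → Mat → Bool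
  mat a b c d == mat a' b' c' d' =
    ⌊ a ≟ a' ⌋ ∧ ⌊ b ≟ b' ⌋ ∧ ⌊ c ≟ c' ⌋ ∧ ⌊ d ≟ d' ⌋

  ind : Bool → ℤ
  ind true  = + 1
  ind false = + 0

  sumℤ : List ℤ → ℤ
  sumℤ = foldr _+_ (+ 0)

  allMats : List Mat
  allMats = concatMap (λ a → concatMap (λ b → concatMap (λ c → map (λ d → mat a b c d)
              elems) elems) elems) elems

  SL₂ : List Mat
  SL₂ = filter (λ A → det A ≟ 𝟙) allMats

  -- An element Σ_g c_g [g] of ℤ[SL₂(F_q)] is represented by its
  -- coefficient function g ↦ c_g (only values on SL₂ matter).
  GroupRing : Set
  GroupRing = Mat → ℤ

  _⋆_ : GroupRing → GroupRing → GroupRing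
  (f ⋆ h) A = sumℤ (concatMap (λ X → map (λ Y → ind ((X ⊗ Y) == A) * (f X * h Y)) SL₂) SL₂)

  unitGR : GroupRing
  unitGR A = ind (A == idMat)

  _^GR_ : GroupRing → ℕ → GroupRing
  f ^GR zero  = unitGR
  f ^GR suc n = f ⋆ (f ^GR n)

  gen : Carrier → Carrier → Mat
  gen x μ = mat x μ (⊝ (μ ⁻¹)) 𝟘

  S : Subgroup F → GroupRing
  S M A = sumℤ (concatMap (λ μ → map (λ x → ind (A == gen x μ)) elems) (Subgroup.elemsM M))

sel2 : {A : Set} → ℕ → A → A → A
sel2 zero          e o = e
sel2 (suc zero)    e o = o
sel2 (suc (suc n)) e o = sel2 n e o

sel4 : {A : Set} → ℕ → A → A → A → A → A
sel4 zero                      w x y z = w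
sel4 (suc zero)                w x y z = x
sel4 (suc (suc zero))          w x y z = y
sel4 (suc (suc (suc zero)))    w x y z = z
sel4 (suc (suc (suc (suc n)))) w x y z = sel4 n w x y z

ε : ℕ → ℕ
ε n = sel2 n 1 0

kk : ℕ → ℕ
kk n = ⌊ n ∸ 1 /2⌋

-- geometric sum  Σ_{i<k} r^i  ( = (r^k - 1)/(r - 1) )
geom : ℕ → ℕ → ℕ
geom r zero    = 0
geom r (suc k) = 1 ℕ.+ r ℕ.* geom r k

-- The values m^n·β_n, m^n·α_n, m^n·γ_n (integers, since n ≥ 1):
--   β_n = q^ε (q^{2k}-1)/(q^2-1),  α_n = β_n - (q^k-1)/(q-1),
--   γ_n = α_n + q^k/m.
mβ : (q m n : ℕ) → ℤ
mβ q m n = (+ (m ℕ.^ n)) * (+ (q ℕ.^ ε n ℕ.* geom (q ℕ.^ 2) (kk n)))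

mα : (q m n : ℕ) → ℤ
mα q m n = (+ (m ℕ.^ n)) * ((+ (q ℕ.^ ε n ℕ.* geom (q ℕ.^ 2) (kk n))) - (+ geom q (kk n)))

mγ : (q m n : ℕ) → ℤ
mγ q m n = mα q m n + (+ (m ℕ.^ (n ∸ 1))) * (+ (q ℕ.^ kk n))

module _ (F : FiniteField) (M : Subgroup F) where
  open FiniteField F
  open Subgroup M

  mκ : ℕ → Carrier → Carrier → ℤ
  mκ n b d with Mem? (⊝ 𝟙)
  ... | yes _ with d ≟ 𝟘
  ...   | yes _ with Mem? b
  ...     | yes _ = sel2 n β γ
    where β = mβ q m n ; γ = mγ q m n
  ...     | no  _ = sel2 n β α
    where β = mβ q m n ; α = mα q m n
  mκ n b d | yes _ | no _ with Mem? d
  ...     | yes _ = sel2 n γ β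
    where β = mβ q m n ; γ = mγ q m n
  ...     | no  _ = sel2 n α β
    where β = mβ q m n ; α = mα q m n
  mκ n b d | no _ with d ≟ 𝟘
  ...   | yes _ with Mem? b | Mem? (⊝ b)
  ...     | yes _ | _     = sel4 n β γ β α
    where β = mβ q m n ; α = mα q m n ; γ = mγ q m n
  ...     | no _  | yes _ = sel4 n β α β γ
    where β = mβ q m n ; α = mα q m n ; γ = mγ q m n
  ...     | no _  | no _  = sel4 n β α β α
    where β = mβ q m n ; α = mα q m n
  mκ n b d | no _ | no _ with Mem? d | Mem? (⊝ d)
  ...     | yes _ | _     = sel4 n γ β α β
    where β = mβ q m n ; α = mα q m n ; γ = mγ q m n
  ...     | no _  | yes _ = sel4 n α β γ β
    where β = mβ q m n ; α = mα q m n ; γ = mγ q m n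
  ...     | no _  | no _  = sel4 n α β α β
    where β = mβ q m n ; α = mα q m n

module Submission where

-- Left multiplication by S acts on coefficient functions by
--   (S ⋆ f)(A) = Σ_{μ∈M} Σ_x f(g(x,μ)⁻¹ A),
-- and for A = (a b ; c d) the second column of g(x,μ)⁻¹ A is (-μd, b/μ + xd).
-- We describe m^n κ_n(b,d) uniformly by a function κ (module ClosedForm):
-- with r = n mod 4 and χ_n(e) = γ_n or α_n according as e ∈ M,
--   κ_n(b,0) = (β, χ(b), β, χ(-b))_r   and   κ_n(b,d) = (χ(d), β, χ(-d), β)_r  (d ≠ 0).
-- Applying S to κ_n then gives, for d = 0, q·m equal terms (χ is constant on
-- cosets of M), and for d ≠ 0, after the substitution y = b/μ + xd, m copies
-- of a full column sum Σ_y κ_n(-μd, y), evaluated by counting |M| = m.  The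
-- identities this requires are exactly the recurrences of β_n, α_n, γ_n from
-- n to n + 1 (module Recurrences), which depend on the parity of n.

open import Defs
open import Level using (0ℓ)
open import Data.Bool using (Bool; true; false; _∧_; if_then_else_)
open import Data.Nat as ℕ using (ℕ; zero; suc; _≥_; s≤s; z≤n)
import Data.Nat.Properties as ℕP
open import Data.Integer as ℤ using (ℤ; +_; -[1+_]; _⊖_; _+_; _*_; _-_)
import Data.Integer.Properties as ℤP
open import Data.Integer.Tactic.RingSolver using (solve-∀)
open import Data.List using (List; []; _∷_; _++_; map; concatMap; filter; length; foldr)
open import Data.List.Properties using (map-concatMap; map-∘)
open import Data.List.Relation.Unary.All using (All; []; _∷_)
open import Data.List.Relation.Unary.AllPairs using (AllPairs; []; _∷_)
open import Data.List.Relation.Unary.Any using (here; there)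
open import Data.List.Membership.Propositional using (_∈_)
open import Data.List.Membership.Propositional.Properties using (∈-filter⁻)
open import Data.Empty using (⊥-elim)
open import Data.Maybe using (Maybe; just; nothing)
open import Function using (_∘_)
open import Data.Product using (_×_; _,_; proj₁; proj₂)
open import Relation.Nullary using (¬_; Dec; yes; no; does)
open import Relation.Nullary.Decidable using (⌊_⌋)
open import Relation.Unary using (Pred; Decidable)
open import Relation.Binary.Definitions using (DecidableEquality)
open import Algebra.Bundles using (CommutativeRing)
open import Algebra.Solver.Ring.AlmostCommutativeRing using (fromCommutativeRing; _-Raw-AlmostCommutative⟶_)
import Algebra.Solver.Ring
import Algebra.Solver.Ring.NaturalCoefficients
import Algebra.Properties.Monoid.Mult.TCOptimised
import Algebra.Properties.Semiring.Mult.TCOptimised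
import Algebra.Properties.Ring
open import Data.Sign as Sign using (Sign)
open import Relation.Binary.PropositionalEquality using (_≡_; refl; sym; trans; cong; cong₂; subst; module ≡-Reasoning)

cong₃ : {A B C D : Set} (f : A → B → C → D) {a a' : A} {b b' : B} {c c' : C} →
        a ≡ a' → b ≡ b' → c ≡ c' → f a b c ≡ f a' b' c'
cong₃ f refl refl refl = refl

cong₄ : {A B C D E : Set} (f : A → B → C → D → E) {a a' : A} {b b' : B} {c c' : C} {d d' : D} →
        a ≡ a' → b ≡ b' → c ≡ c' → d ≡ d' → f a b c d ≡ f a' b' c' d'
cong₄ f refl refl refl refl = refl

module FiniteSums where

  sumList : List ℤ → ℤ
  sumList = foldr _+_ (+ 0)

  ∑ : {A : Set} → List A → (A → ℤ) → ℤ
  ∑ L f = sumList (map f L)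

  [_] : Bool → ℤ
  [ true ]  = + 1
  [ false ] = + 0

  [∧] : ∀ p r → [ p ∧ r ] ≡ [ p ] * [ r ]
  [∧] true  r = sym (ℤP.*-identityˡ [ r ])
  [∧] false r = refl

  sumList-++ : ∀ xs ys → sumList (xs ++ ys) ≡ sumList xs + sumList ys
  sumList-++ []       ys = sym (ℤP.+-identityˡ _)
  sumList-++ (x ∷ xs) ys = trans (cong (_+_ x) (sumList-++ xs ys)) (sym (ℤP.+-assoc x _ _))

  module _ {A : Set} where

    sumList-concatMap : (g : A → List ℤ) (L : List A) →
      sumList (concatMap g L) ≡ ∑ L (sumList ∘ g)
    sumList-concatMap g []      = refl
    sumList-concatMap g (x ∷ L) =
      trans (sumList-++ (g x) _) (cong (_+_ (sumList (g x))) (sumList-concatMap g L))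

    ∑-congIn : {f g : A → ℤ} (L : List A) → (∀ x → x ∈ L → f x ≡ g x) → ∑ L f ≡ ∑ L g
    ∑-congIn []      h = refl
    ∑-congIn (x ∷ L) h = cong₂ _+_ (h x (here refl)) (∑-congIn L (λ y y∈ → h y (there y∈)))

    ∑-cong : {f g : A → ℤ} (L : List A) → (∀ x → f x ≡ g x) → ∑ L f ≡ ∑ L g
    ∑-cong L h = ∑-congIn L (λ x _ → h x)

    ∑-+ : (L : List A) (f g : A → ℤ) → ∑ L (λ x → f x + g x) ≡ ∑ L f + ∑ L g
    ∑-+ []      f g = refl
    ∑-+ (x ∷ L) f g = trans (cong (_+_ (f x + g x)) (∑-+ L f g)) (swap (f x) (g x) (∑ L f) (∑ L g))
      where
      swap : ∀ a b c d → (a + b) + (c + d) ≡ (a + c) + (b + d)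
      swap = solve-∀

    ∑-*ˡ : (c : ℤ) (L : List A) (f : A → ℤ) → ∑ L (λ x → c * f x) ≡ c * ∑ L f
    ∑-*ˡ c []      f = sym (ℤP.*-zeroʳ c)
    ∑-*ˡ c (x ∷ L) f = trans (cong (_+_ (c * f x)) (∑-*ˡ c L f)) (sym (ℤP.*-distribˡ-+ c (f x) _))

    ∑-*ʳ : (c : ℤ) (L : List A) (f : A → ℤ) → ∑ L (λ x → f x * c) ≡ ∑ L f * c
    ∑-*ʳ c L f = trans (∑-cong L (λ x → ℤP.*-comm (f x) c)) (trans (∑-*ˡ c L f) (ℤP.*-comm c _))

    ∑-const : (L : List A) (c : ℤ) → ∑ L (λ _ → c) ≡ + length L * c
    ∑-const []      c = sym (ℤP.*-zeroˡ c)
    ∑-const (x ∷ L) c = trans (cong (_+_ c) (∑-const L c)) (step c (+ length L))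
      where
      step : ∀ c l → c + l * c ≡ (+ 1 + l) * c
      step = solve-∀

    ∑-filter : {P : Pred A 0ℓ} (P? : Decidable P) (L : List A) (f : A → ℤ) →
      ∑ (filter P? L) f ≡ ∑ L (λ x → [ does (P? x) ] * f x)
    ∑-filter P? []      f = refl
    ∑-filter P? (x ∷ L) f with P? x
    ... | yes _ = cong₂ _+_ (sym (ℤP.*-identityˡ (f x))) (∑-filter P? L f)
    ... | no  _ = trans (∑-filter P? L f) (sym (ℤP.+-identityˡ _))

    count-filter : {P : Pred A 0ℓ} (P? : Decidable P) (L : List A) →
      ∑ L (λ x → [ does (P? x) ]) ≡ + length (filter P? L)
    count-filter P? L = begin
      ∑ L (λ x → [ does (P? x) ])         ≡⟨ ∑-cong L (λ x → sym (ℤP.*-identityʳ _)) ⟩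
      ∑ L (λ x → [ does (P? x) ] * + 1)   ≡⟨ sym (∑-filter P? L (λ _ → + 1)) ⟩
      ∑ (filter P? L) (λ _ → + 1)          ≡⟨ ∑-const (filter P? L) (+ 1) ⟩
      + length (filter P? L) * + 1         ≡⟨ ℤP.*-identityʳ _ ⟩
      + length (filter P? L)               ∎
      where open ≡-Reasoning

  module _ {A B : Set} where

    ∑-concatMap : (g : A → List B) (L : List A) (G : B → ℤ) →
      ∑ (concatMap g L) G ≡ ∑ L (λ x → ∑ (g x) G)
    ∑-concatMap g L G = trans (cong sumList (map-concatMap G g L)) (sumList-concatMap (map G ∘ g) L)

    ∑-map : (h : A → B) (L : List A) (G : B → ℤ) → ∑ (map h L) G ≡ ∑ L (G ∘ h)
    ∑-map h L G = cong sumList (sym (map-∘ L))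

    ∑-swap : (L₁ : List A) (L₂ : List B) (f : A → B → ℤ) →
      ∑ L₁ (λ x → ∑ L₂ (f x)) ≡ ∑ L₂ (λ y → ∑ L₁ (λ x → f x y))
    ∑-swap []       L₂ f = sym (trans (∑-const L₂ (+ 0)) (ℤP.*-zeroʳ (+ length L₂)))
    ∑-swap (x ∷ L₁) L₂ f = trans (cong (_+_ (∑ L₂ (f x))) (∑-swap L₁ L₂ f)) (sym (∑-+ L₂ (f x) _))

  module Enumerated {A : Set} (_≟_ : DecidableEquality A) (L : List A)
                    (unique : AllPairs (λ x y → ¬ x ≡ y) L) (complete : ∀ x → x ∈ L) where

    δ : A → A → ℤ
    δ x z = [ ⌊ x ≟ z ⌋ ]

    δ-self : ∀ z → δ z z ≡ + 1
    δ-self z with z ≟ z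
    ... | yes _  = refl
    ... | no z≢z = ⊥-elim (z≢z refl)

    δ-≢ : ∀ {x z} → ¬ x ≡ z → δ x z ≡ + 0
    δ-≢ {x} {z} x≢z with x ≟ z
    ... | yes x≡z = ⊥-elim (x≢z x≡z)
    ... | no  _   = refl

    δ-sym : ∀ x z → δ x z ≡ δ z x
    δ-sym x z with x ≟ z | z ≟ x
    ... | yes _   | yes _   = refl
    ... | no  _   | no  _   = refl
    ... | yes x≡z | no  z≢x = ⊥-elim (z≢x (sym x≡z))
    ... | no  x≢z | yes z≡x = ⊥-elim (x≢z (sym z≡x))

    private
      ∑-δ-absent : ∀ z (K : List A) (g : A → ℤ) → All (λ x → ¬ z ≡ x) K → ∑ K (λ x → δ x z * g x) ≡ + 0
      ∑-δ-absent z []      g []         = refl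
      ∑-δ-absent z (x ∷ K) g (z≢x ∷ ps) with x ≟ z
      ... | yes x≡z = ⊥-elim (z≢x (sym x≡z))
      ... | no  _   = trans (ℤP.+-identityˡ _) (∑-δ-absent z K g ps)

      absent : ∀ {z} {K : List A} → All (λ x → ¬ z ≡ x) K → ∀ {y} → y ∈ K → ¬ z ≡ y
      absent (p ∷ ps) (here refl) = p
      absent (p ∷ ps) (there y∈)  = absent ps y∈

      ∑-δ-in : ∀ (K : List A) → AllPairs (λ x y → ¬ x ≡ y) K → ∀ z → z ∈ K → (g : A → ℤ) →
        ∑ K (λ x → δ x z * g x) ≡ g z
      ∑-δ-in (x ∷ K) (ps ∷ _) z (here refl) g =
        trans (cong₂ _+_ (trans (cong (_* g z) (δ-self z)) (ℤP.*-identityˡ (g z))) (∑-δ-absent z K g ps))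
              (ℤP.+-identityʳ (g z))
      ∑-δ-in (x ∷ K) (ps ∷ u) z (there z∈) g with x ≟ z
      ... | yes refl = ⊥-elim (absent ps z∈ refl)
      ... | no  _    = trans (ℤP.+-identityˡ _) (∑-δ-in K u z z∈ g)

    ∑-δ : ∀ z (g : A → ℤ) → ∑ L (λ x → δ x z * g x) ≡ g z
    ∑-δ z = ∑-δ-in L unique z (complete z)

    ∑-reindex : (φ ψ : A → A) → (∀ x → ψ (φ x) ≡ x) → (∀ y → φ (ψ y) ≡ y) →
      (h : A → ℤ) → ∑ L (h ∘ φ) ≡ ∑ L h
    ∑-reindex φ ψ ψφ φψ h = begin
      ∑ L (h ∘ φ)                                ≡⟨ ∑-cong L (λ x → sym (∑-δ (φ x) h)) ⟩
      ∑ L (λ x → ∑ L (λ y → δ y (φ x) * h y))    ≡⟨ ∑-swap L L _ ⟩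
      ∑ L (λ y → ∑ L (λ x → δ y (φ x) * h y))    ≡⟨ ∑-cong L (λ y → ∑-*ʳ (h y) L (λ x → δ y (φ x))) ⟩
      ∑ L (λ y → ∑ L (λ x → δ y (φ x)) * h y)    ≡⟨ ∑-cong L (λ y → cong (_* h y) (preimage y)) ⟩
      ∑ L (λ y → + 1 * h y)                      ≡⟨ ∑-cong L (λ y → ℤP.*-identityˡ (h y)) ⟩
      ∑ L h                                      ∎
      where
      open ≡-Reasoning
      δ-transpose : ∀ x y → δ y (φ x) ≡ δ x (ψ y)
      δ-transpose x y with y ≟ φ x | x ≟ ψ y
      ... | yes _ | yes _ = refl
      ... | no  _ | no  _ = refl
      ... | yes y≡φx | no x≢ψy = ⊥-elim (x≢ψy (trans (sym (ψφ x)) (cong ψ (sym y≡φx))))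
      ... | no y≢φx | yes x≡ψy = ⊥-elim (y≢φx (trans (sym (φψ y)) (cong φ (sym x≡ψy))))
      preimage : ∀ y → ∑ L (λ x → δ y (φ x)) ≡ + 1
      preimage y = begin
        ∑ L (λ x → δ y (φ x))        ≡⟨ ∑-cong L (λ x → trans (δ-transpose x y) (sym (ℤP.*-identityʳ _))) ⟩
        ∑ L (λ x → δ x (ψ y) * + 1)  ≡⟨ ∑-δ (ψ y) (λ _ → + 1) ⟩
        + 1                          ∎

-- The ring solver over F_q.  Its coefficients are integers, interpreted in
-- F_q through the ring homomorphism  ℤ → F_q,  i ↦ i·1.
module FieldSolver (F : FiniteField) where
  open FiniteField F

  commutativeRing : CommutativeRing 0ℓ 0ℓ
  commutativeRing = record { isCommutativeRing = isCommutativeRing }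

  open CommutativeRing commutativeRing
    using (+-identityˡ; +-identityʳ; *-identityˡ; zeroʳ; -‿inverseʳ;
           +-monoid; semiring; ring; commutativeSemiring)
  open Algebra.Properties.Monoid.Mult.TCOptimised +-monoid using (×-homo-+) renaming (_×_ to _×ₙ_)
  open Algebra.Properties.Semiring.Mult.TCOptimised semiring using (×1-homo-*)
  open Algebra.Properties.Ring ring using (-‿involutive; -‿+-comm; -1*x≈-x; -0#≈0#; -‿distribˡ-*)

  -- rearrangements in the additive/multiplicative monoids, treating ⊝ x as atoms
  private
    module Monoidal = Algebra.Solver.Ring.NaturalCoefficients commutativeSemiring (λ _ _ → nothing)

  -- n ↦ n·1  (with 0 ↦ 𝟘 and 1 ↦ 𝟙 definitionally)
  ℕ↑ : ℕ → Carrier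
  ℕ↑ n = n ×ₙ 𝟙

  ℤ↑ : ℤ → Carrier
  ℤ↑ (+ n)    = ℕ↑ n
  ℤ↑ -[1+ n ] = ⊝ ℕ↑ (suc n)

  ℤ↑-⊖ : ∀ m n → ℤ↑ (m ⊖ n) ≡ ℕ↑ m ⊕ ⊝ ℕ↑ n
  ℤ↑-⊖ m       zero    rewrite ℤP.⊖-≥ {m} {0} z≤n = sym (trans (cong (ℕ↑ m ⊕_) -0#≈0#) (+-identityʳ _))
  ℤ↑-⊖ zero    (suc n) rewrite ℤP.⊖-< {0} {suc n} (s≤s z≤n) = sym (+-identityˡ _)
  ℤ↑-⊖ (suc m) (suc n) rewrite ℤP.[1+m]⊖[1+n]≡m⊖n m n = begin
    ℤ↑ (m ⊖ n)                           ≡⟨ ℤ↑-⊖ m n ⟩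
    ℕ↑ m ⊕ ⊝ ℕ↑ n                        ≡⟨ sym (+-identityˡ _) ⟩
    𝟘 ⊕ (ℕ↑ m ⊕ ⊝ ℕ↑ n)                  ≡⟨ cong (_⊕ (ℕ↑ m ⊕ ⊝ ℕ↑ n)) (sym (-‿inverseʳ 𝟙)) ⟩
    (𝟙 ⊕ ⊝ 𝟙) ⊕ (ℕ↑ m ⊕ ⊝ ℕ↑ n)          ≡⟨ Monoidal.solve 4 (λ a b c d → (a Monoidal.:+ c) Monoidal.:+ (b Monoidal.:+ d) Monoidal.:= (a Monoidal.:+ b) Monoidal.:+ (c Monoidal.:+ d)) refl 𝟙 (ℕ↑ m) (⊝ 𝟙) (⊝ ℕ↑ n) ⟩
    (𝟙 ⊕ ℕ↑ m) ⊕ (⊝ 𝟙 ⊕ ⊝ ℕ↑ n)          ≡⟨ cong ((𝟙 ⊕ ℕ↑ m) ⊕_) (-‿+-comm 𝟙 (ℕ↑ n)) ⟩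
    (𝟙 ⊕ ℕ↑ m) ⊕ ⊝ (𝟙 ⊕ ℕ↑ n)            ≡⟨ sym (cong₂ (λ u v → u ⊕ ⊝ v) (×-homo-+ 𝟙 1 m) (×-homo-+ 𝟙 1 n)) ⟩
    ℕ↑ (suc m) ⊕ ⊝ ℕ↑ (suc n)            ∎
    where open ≡-Reasoning

  ℤ↑-+ : ∀ i j → ℤ↑ (i ℤ.+ j) ≡ ℤ↑ i ⊕ ℤ↑ j
  ℤ↑-+ (+ m)    (+ n)    = ×-homo-+ 𝟙 m n
  ℤ↑-+ (+ m)    -[1+ n ] = ℤ↑-⊖ m (suc n)
  ℤ↑-+ -[1+ m ] (+ n)    = trans (ℤ↑-⊖ n (suc m)) (CommutativeRing.+-comm commutativeRing _ _)
  ℤ↑-+ -[1+ m ] -[1+ n ] = begin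
    ⊝ ℕ↑ (suc (suc (m ℕ.+ n)))         ≡⟨ cong (λ k → ⊝ ℕ↑ (suc k)) (sym (ℕP.+-suc m n)) ⟩
    ⊝ ℕ↑ (suc m ℕ.+ suc n)             ≡⟨ cong ⊝_ (×-homo-+ 𝟙 (suc m) (suc n)) ⟩
    ⊝ (ℕ↑ (suc m) ⊕ ℕ↑ (suc n))        ≡⟨ sym (-‿+-comm _ _) ⟩
    ⊝ ℕ↑ (suc m) ⊕ ⊝ ℕ↑ (suc n)        ∎
    where open ≡-Reasoning

  sign↑ : Sign → Carrier
  sign↑ Sign.+ = 𝟙
  sign↑ Sign.- = ⊝ 𝟙

  sign↑-* : ∀ s t → sign↑ (s Sign.* t) ≡ sign↑ s · sign↑ t
  sign↑-* Sign.+ t      = sym (*-identityˡ _)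
  sign↑-* Sign.- Sign.+ = sym (CommutativeRing.*-identityʳ commutativeRing _)
  sign↑-* Sign.- Sign.- = sym (trans (sym (-‿distribˡ-* 𝟙 (⊝ 𝟙))) (trans (cong ⊝_ (*-identityˡ (⊝ 𝟙))) (-‿involutive 𝟙)))

  ℤ↑-◃ : ∀ s n → ℤ↑ (s ℤ.◃ n) ≡ sign↑ s · ℕ↑ n
  ℤ↑-◃ s      zero    = sym (zeroʳ _)
  ℤ↑-◃ Sign.+ (suc n) = sym (*-identityˡ _)
  ℤ↑-◃ Sign.- (suc n) = sym (-1*x≈-x _)

  ℤ↑-signAbs : ∀ i → ℤ↑ i ≡ sign↑ (ℤ.sign i) · ℕ↑ ℤ.∣ i ∣
  ℤ↑-signAbs (+ n)    = sym (*-identityˡ _)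
  ℤ↑-signAbs -[1+ n ] = sym (-1*x≈-x _)

  ℤ↑-* : ∀ i j → ℤ↑ (i ℤ.* j) ≡ ℤ↑ i · ℤ↑ j
  ℤ↑-* i j = begin
    ℤ↑ (i ℤ.* j)                                    ≡⟨ ℤ↑-◃ (ℤ.sign i Sign.* ℤ.sign j) (ℤ.∣ i ∣ ℕ.* ℤ.∣ j ∣) ⟩
    sign↑ (si Sign.* sj) · ℕ↑ (ℤ.∣ i ∣ ℕ.* ℤ.∣ j ∣)  ≡⟨ cong₂ _·_ (sign↑-* si sj) (×1-homo-* ℤ.∣ i ∣ ℤ.∣ j ∣) ⟩
    (sign↑ si · sign↑ sj) · (ℕ↑ ℤ.∣ i ∣ · ℕ↑ ℤ.∣ j ∣) ≡⟨ Monoidal.solve 4 (λ a b c d → (a Monoidal.:* b) Monoidal.:* (c Monoidal.:* d) Monoidal.:= (a Monoidal.:* c) Monoidal.:* (b Monoidal.:* d)) refl (sign↑ si) (sign↑ sj) (ℕ↑ ℤ.∣ i ∣) (ℕ↑ ℤ.∣ j ∣) ⟩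
    (sign↑ si · ℕ↑ ℤ.∣ i ∣) · (sign↑ sj · ℕ↑ ℤ.∣ j ∣) ≡⟨ sym (cong₂ _·_ (ℤ↑-signAbs i) (ℤ↑-signAbs j)) ⟩
    ℤ↑ i · ℤ↑ j                                     ∎
    where
    open ≡-Reasoning
    si = ℤ.sign i
    sj = ℤ.sign j

  ℤ↑-neg : ∀ i → ℤ↑ (ℤ.- i) ≡ ⊝ ℤ↑ i
  ℤ↑-neg -[1+ n ]  = sym (-‿involutive _)
  ℤ↑-neg (+ zero)  = sym -0#≈0#
  ℤ↑-neg (+ suc n) = refl

  ℤ↑-homomorphism : ℤ.+-*-rawRing -Raw-AlmostCommutative⟶ fromCommutativeRing commutativeRing
  ℤ↑-homomorphism = record
    { ⟦_⟧ = ℤ↑ ; +-homo = ℤ↑-+ ; *-homo = ℤ↑-* ; -‿homo = ℤ↑-neg ; 0-homo = refl ; 1-homo = refl }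

  private
    ℤ↑-equal? : ∀ i j → Maybe (ℤ↑ i ≡ ℤ↑ j)
    ℤ↑-equal? i j with i ℤ.≟ j
    ... | yes i≡j = just (cong ℤ↑ i≡j)
    ... | no  _   = nothing

  open Algebra.Solver.Ring ℤ.+-*-rawRing (fromCommutativeRing commutativeRing) ℤ↑-homomorphism ℤ↑-equal? public
    using (solve; _:=_; _:+_; _:*_; :-_; con)

module FieldFacts (F : FiniteField) where
  open FiniteField F
  open FieldSolver F

  ⊝𝟘 : ⊝ 𝟘 ≡ 𝟘
  ⊝𝟘 = solve 0 (:- con (+ 0) := con (+ 0)) refl

  ⊝⊝ : ∀ x → ⊝ (⊝ x) ≡ x
  ⊝⊝ = solve 1 (λ x → :- (:- x) := x) refl

  ⊝-as-product : ∀ x → ⊝ x ≡ (⊝ 𝟙) · x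
  ⊝-as-product = solve 1 (λ x → :- x := (:- con (+ 1)) :* x) refl

  ⁻¹-cancelˡ : ∀ μ y → ¬ μ ≡ 𝟘 → μ ⁻¹ · (μ · y) ≡ y
  ⁻¹-cancelˡ μ y μ≢𝟘 = begin
    μ ⁻¹ · (μ · y)   ≡⟨ solve 3 (λ i u y → i :* (u :* y) := (u :* i) :* y) refl (μ ⁻¹) μ y ⟩
    (μ · μ ⁻¹) · y   ≡⟨ cong (_· y) (⁻¹-inverse μ μ≢𝟘) ⟩
    𝟙 · y            ≡⟨ solve 1 (λ y → con (+ 1) :* y := y) refl y ⟩
    y                ∎
    where open ≡-Reasoning

  ·-nonzero : ∀ μ y → ¬ μ ≡ 𝟘 → ¬ y ≡ 𝟘 → ¬ μ · y ≡ 𝟘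
  ·-nonzero μ y μ≢𝟘 y≢𝟘 μy≡𝟘 = y≢𝟘 (begin
    y               ≡⟨ sym (⁻¹-cancelˡ μ y μ≢𝟘) ⟩
    μ ⁻¹ · (μ · y)  ≡⟨ cong (μ ⁻¹ ·_) μy≡𝟘 ⟩
    μ ⁻¹ · 𝟘        ≡⟨ solve 1 (λ i → i :* con (+ 0) := con (+ 0)) refl (μ ⁻¹) ⟩
    𝟘               ∎)
    where open ≡-Reasoning

  affine-inverseˡ : ∀ c d → ¬ d ≡ 𝟘 → ∀ x → ((c ⊕ x · d) ⊕ ⊝ c) · d ⁻¹ ≡ x
  affine-inverseˡ c d d≢𝟘 x = begin
    ((c ⊕ x · d) ⊕ ⊝ c) · d ⁻¹  ≡⟨ solve 4 (λ c x d i → ((c :+ x :* d) :+ :- c) :* i := x :* (d :* i)) refl c x d (d ⁻¹) ⟩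
    x · (d · d ⁻¹)               ≡⟨ cong (x ·_) (⁻¹-inverse d d≢𝟘) ⟩
    x · 𝟙                        ≡⟨ solve 1 (λ x → x :* con (+ 1) := x) refl x ⟩
    x                            ∎
    where open ≡-Reasoning

  affine-inverseʳ : ∀ c d → ¬ d ≡ 𝟘 → ∀ y → c ⊕ ((y ⊕ ⊝ c) · d ⁻¹) · d ≡ y
  affine-inverseʳ c d d≢𝟘 y = begin
    c ⊕ ((y ⊕ ⊝ c) · d ⁻¹) · d  ≡⟨ solve 4 (λ c y d i → c :+ ((y :+ :- c) :* i) :* d := c :+ (y :+ :- c) :* (d :* i)) refl c y d (d ⁻¹) ⟩
    c ⊕ (y ⊕ ⊝ c) · (d · d ⁻¹)  ≡⟨ cong (λ t → c ⊕ (y ⊕ ⊝ c) · t) (⁻¹-inverse d d≢𝟘) ⟩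
    c ⊕ (y ⊕ ⊝ c) · 𝟙           ≡⟨ solve 2 (λ c y → c :+ (y :+ :- c) :* con (+ 1) := y) refl c y ⟩
    y                            ∎
    where open ≡-Reasoning

  det-d≡𝟘⇒b≢𝟘 : ∀ a b c → a · 𝟘 ⊕ ⊝ (b · c) ≡ 𝟙 → ¬ b ≡ 𝟘
  det-d≡𝟘⇒b≢𝟘 a b c det≡𝟙 refl =
    𝟘≢𝟙 (trans (sym (solve 2 (λ a c → a :* con (+ 0) :+ :- (con (+ 0) :* c) := con (+ 0)) refl a c)) det≡𝟙)

  det-d≡𝟘⇒c : ∀ a b c → a · 𝟘 ⊕ ⊝ (b · c) ≡ 𝟙 → c ≡ ⊝ (b ⁻¹)
  det-d≡𝟘⇒c a b c det≡𝟙 = begin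
    c                       ≡⟨ sym (⁻¹-cancelˡ b c (det-d≡𝟘⇒b≢𝟘 a b c det≡𝟙)) ⟩
    b ⁻¹ · (b · c)          ≡⟨ solve 4 (λ a b c i → i :* (b :* c) := :- (i :* (a :* con (+ 0) :+ :- (b :* c)))) refl a b c (b ⁻¹) ⟩
    ⊝ (b ⁻¹ · (a · 𝟘 ⊕ ⊝ (b · c))) ≡⟨ cong (λ t → ⊝ (b ⁻¹ · t)) det≡𝟙 ⟩
    ⊝ (b ⁻¹ · 𝟙)            ≡⟨ cong ⊝_ (solve 1 (λ i → i :* con (+ 1) := i) refl (b ⁻¹)) ⟩
    ⊝ (b ⁻¹)                ∎
    where open ≡-Reasoning

  module Members (M : Subgroup F) where
    open Subgroup M

    Mem-cancelˡ : ∀ {μ y} → Mem μ → Mem (μ · y) → Mem y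
    Mem-cancelˡ {μ} {y} μ∈M μy∈M = subst Mem (⁻¹-cancelˡ μ y (nonzero μ∈M)) (mul (inv μ∈M) μy∈M)

    Mem-⊝ : Mem (⊝ 𝟙) → ∀ {y} → Mem y → Mem (⊝ y)
    Mem-⊝ ⊝𝟙∈M {y} y∈M = subst Mem (sym (⊝-as-product y)) (mul ⊝𝟙∈M y∈M)

    ⊝∉M : Mem (⊝ 𝟙) → ∀ {y} → ¬ Mem y → ¬ Mem (⊝ y)
    ⊝∉M ⊝𝟙∈M {y} y∉M ⊝y∈M = y∉M (subst Mem (⊝⊝ y) (Mem-⊝ ⊝𝟙∈M ⊝y∈M))

    Mem-both⇒⊝𝟙 : ∀ {y} → Mem y → Mem (⊝ y) → Mem (⊝ 𝟙)
    Mem-both⇒⊝𝟙 {y} y∈M ⊝y∈M = subst Mem ⊝y·y⁻¹≡⊝𝟙 (mul ⊝y∈M (inv y∈M))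
      where
      ⊝y·y⁻¹≡⊝𝟙 : (⊝ y) · y ⁻¹ ≡ ⊝ 𝟙
      ⊝y·y⁻¹≡⊝𝟙 = trans (solve 2 (λ y i → (:- y) :* i := :- (y :* i)) refl y (y ⁻¹)) (cong ⊝_ (⁻¹-inverse y (nonzero y∈M)))

module Matrices (F : FiniteField) where
  open FiniteField F
  open FieldSolver F using (solve; _:=_; _:+_; _:*_; :-_; con)
  open FiniteSums
  open Enumerated _≟_ elems elems-unique elems-complete

  infixl 7 _⊠_
  _⊠_ : Mat F → Mat F → Mat F
  _⊠_ = _⊗_ F

  mat-cong : ∀ {a b c d a' b' c' d'} → a ≡ a' → b ≡ b' → c ≡ c' → d ≡ d' → mat {F} a b c d ≡ mat a' b' c' d'
  mat-cong refl refl refl refl = refl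

  ⊠-assoc : ∀ X Y Z → (X ⊠ Y) ⊠ Z ≡ X ⊠ (Y ⊠ Z)
  ⊠-assoc (mat a b c d) (mat a' b' c' d') (mat a'' b'' c'' d'') =
    mat-cong (entry a b a'' c'') (entry a b b'' d'') (entry c d a'' c'') (entry c d b'' d'')
    where
    -- (u v)·Y·(s t)ᵀ computed in both orders
    entry : ∀ u v s t → ((u · a') ⊕ (v · c')) · s ⊕ ((u · b') ⊕ (v · d')) · t
                      ≡ u · ((a' · s) ⊕ (b' · t)) ⊕ v · ((c' · s) ⊕ (d' · t))
    entry u v s t = solve 8 (λ u v s t a' b' c' d' →
      ((u :* a') :+ (v :* c')) :* s :+ ((u :* b') :+ (v :* d')) :* t
        := u :* ((a' :* s) :+ (b' :* t)) :+ v :* ((c' :* s) :+ (d' :* t))) refl u v s t a' b' c' d'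

  ⊠-identityˡ : ∀ Y → idMat F ⊠ Y ≡ Y
  ⊠-identityˡ (mat a b c d) = mat-cong (top a c) (top b d) (bottom a c) (bottom b d)
    where
    top : ∀ u v → 𝟙 · u ⊕ 𝟘 · v ≡ u
    top = solve 2 (λ u v → con (+ 1) :* u :+ con (+ 0) :* v := u) refl
    bottom : ∀ u v → 𝟘 · u ⊕ 𝟙 · v ≡ v
    bottom = solve 2 (λ u v → con (+ 0) :* u :+ con (+ 1) :* v := v) refl

  ⊠-identityʳ : ∀ X → X ⊠ idMat F ≡ X
  ⊠-identityʳ (mat a b c d) = mat-cong (left a b) (right a b) (left c d) (right c d)
    where
    left : ∀ u v → u · 𝟙 ⊕ v · 𝟘 ≡ u
    left = solve 2 (λ u v → u :* con (+ 1) :+ v :* con (+ 0) := u) refl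
    right : ∀ u v → u · 𝟘 ⊕ v · 𝟙 ≡ v
    right = solve 2 (λ u v → u :* con (+ 0) :+ v :* con (+ 1) := v) refl

  det-⊠ : ∀ X Y → det F (X ⊠ Y) ≡ det F X · det F Y
  det-⊠ (mat a b c d) (mat a' b' c' d') = solve 8 (λ a b c d a' b' c' d' →
    ((a :* a') :+ (b :* c')) :* ((c :* b') :+ (d :* d')) :+ :- (((a :* b') :+ (b :* d')) :* ((c :* a') :+ (d :* c')))
      := ((a :* d) :+ :- (b :* c)) :* ((a' :* d') :+ :- (b' :* c'))) refl a b c d a' b' c' d'

  genInv : Carrier → Carrier → Mat F
  genInv x μ = mat 𝟘 (⊝ μ) (μ ⁻¹) x

  module Generator {x μ : Carrier} (μ≢𝟘 : ¬ μ ≡ 𝟘) where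
    private
      μμ⁻¹ : μ · μ ⁻¹ ≡ 𝟙
      μμ⁻¹ = ⁻¹-inverse μ μ≢𝟘
      by-μμ⁻¹ : ∀ {L} → L ≡ μ · μ ⁻¹ → L ≡ 𝟙
      by-μμ⁻¹ e = trans e μμ⁻¹

    gen⊠genInv : gen F x μ ⊠ genInv x μ ≡ idMat F
    gen⊠genInv = mat-cong
      (by-μμ⁻¹ (solve 3 (λ x μ i → x :* con (+ 0) :+ μ :* i := μ :* i) refl x μ (μ ⁻¹)))
      (solve 2 (λ x μ → x :* (:- μ) :+ μ :* x := con (+ 0)) refl x μ)
      (solve 1 (λ i → (:- i) :* con (+ 0) :+ con (+ 0) :* i := con (+ 0)) refl (μ ⁻¹))
      (by-μμ⁻¹ (solve 3 (λ x μ i → (:- i) :* (:- μ) :+ con (+ 0) :* x := μ :* i) refl x μ (μ ⁻¹)))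

    genInv⊠gen : genInv x μ ⊠ gen F x μ ≡ idMat F
    genInv⊠gen = mat-cong
      (by-μμ⁻¹ (solve 3 (λ x μ i → con (+ 0) :* x :+ (:- μ) :* (:- i) := μ :* i) refl x μ (μ ⁻¹)))
      (solve 1 (λ μ → con (+ 0) :* μ :+ (:- μ) :* con (+ 0) := con (+ 0)) refl μ)
      (solve 2 (λ x i → i :* x :+ x :* (:- i) := con (+ 0)) refl x (μ ⁻¹))
      (by-μμ⁻¹ (solve 3 (λ x μ i → i :* μ :+ x :* con (+ 0) := μ :* i) refl x μ (μ ⁻¹)))

    det-gen : det F (gen F x μ) ≡ 𝟙
    det-gen = by-μμ⁻¹ (solve 3 (λ x μ i → x :* con (+ 0) :+ :- (μ :* (:- i)) := μ :* i) refl x μ (μ ⁻¹))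

    det-genInv : det F (genInv x μ) ≡ 𝟙
    det-genInv = by-μμ⁻¹ (solve 3 (λ x μ i → con (+ 0) :* x :+ :- ((:- μ) :* i) := μ :* i) refl x μ (μ ⁻¹))

    det-genInv⊠ : ∀ A → det F A ≡ 𝟙 → det F (genInv x μ ⊠ A) ≡ 𝟙
    det-genInv⊠ A det≡𝟙 = trans (det-⊠ (genInv x μ) A) (trans (cong₂ _·_ det-genInv det≡𝟙)
                            (solve 0 (con (+ 1) :* con (+ 1) := con (+ 1)) refl))

    gen⊠Y≡A⇔Y≡genInv⊠A : ∀ Y A → (gen F x μ ⊠ Y ≡ A → Y ≡ genInv x μ ⊠ A) × (Y ≡ genInv x μ ⊠ A → gen F x μ ⊠ Y ≡ A)
    gen⊠Y≡A⇔Y≡genInv⊠A Y A = to , from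
      where
      open ≡-Reasoning
      to : gen F x μ ⊠ Y ≡ A → Y ≡ genInv x μ ⊠ A
      to gY≡A = begin
        Y                                ≡⟨ sym (⊠-identityˡ Y) ⟩
        idMat F ⊠ Y                      ≡⟨ cong (_⊠ Y) (sym genInv⊠gen) ⟩
        (genInv x μ ⊠ gen F x μ) ⊠ Y     ≡⟨ ⊠-assoc _ _ _ ⟩
        genInv x μ ⊠ (gen F x μ ⊠ Y)     ≡⟨ cong (genInv x μ ⊠_) gY≡A ⟩
        genInv x μ ⊠ A                   ∎
      from : Y ≡ genInv x μ ⊠ A → gen F x μ ⊠ Y ≡ A
      from refl = begin
        gen F x μ ⊠ (genInv x μ ⊠ A)     ≡⟨ sym (⊠-assoc _ _ _) ⟩
        (gen F x μ ⊠ genInv x μ) ⊠ A     ≡⟨ cong (_⊠ A) gen⊠genInv ⟩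
        idMat F ⊠ A                      ≡⟨ ⊠-identityˡ A ⟩
        A                                ∎

    genInv⊠A≡I⇔A≡gen : ∀ A → (genInv x μ ⊠ A ≡ idMat F → A ≡ gen F x μ) × (A ≡ gen F x μ → genInv x μ ⊠ A ≡ idMat F)
    genInv⊠A≡I⇔A≡gen A = to , from
      where
      to : genInv x μ ⊠ A ≡ idMat F → A ≡ gen F x μ
      to e = sym (trans (sym (⊠-identityʳ (gen F x μ))) (proj₂ (gen⊠Y≡A⇔Y≡genInv⊠A (idMat F) A) (sym e)))
      from : A ≡ gen F x μ → genInv x μ ⊠ A ≡ idMat F
      from e = sym (proj₁ (gen⊠Y≡A⇔Y≡genInv⊠A (idMat F) A) (trans (⊠-identityʳ (gen F x μ)) (sym e)))

  ind≡[] : ∀ p → ind F p ≡ [ p ]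
  ind≡[] true  = refl
  ind≡[] false = refl

  ==-δ : ∀ a b c d a' b' c' d' → ind F (_==_ F (mat a b c d) (mat a' b' c' d')) ≡ δ a a' * (δ b b' * (δ c c' * δ d d'))
  ==-δ a b c d a' b' c' d' = begin
    ind F (⌊ a ≟ a' ⌋ ∧ ⌊ b ≟ b' ⌋ ∧ ⌊ c ≟ c' ⌋ ∧ ⌊ d ≟ d' ⌋)  ≡⟨ ind≡[] _ ⟩
    [ ⌊ a ≟ a' ⌋ ∧ ⌊ b ≟ b' ⌋ ∧ ⌊ c ≟ c' ⌋ ∧ ⌊ d ≟ d' ⌋ ]      ≡⟨ [∧] ⌊ a ≟ a' ⌋ _ ⟩
    δ a a' * [ ⌊ b ≟ b' ⌋ ∧ ⌊ c ≟ c' ⌋ ∧ ⌊ d ≟ d' ⌋ ]         ≡⟨ cong (δ a a' *_) ([∧] ⌊ b ≟ b' ⌋ _) ⟩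
    δ a a' * (δ b b' * [ ⌊ c ≟ c' ⌋ ∧ ⌊ d ≟ d' ⌋ ])           ≡⟨ cong (λ t → δ a a' * (δ b b' * t)) ([∧] ⌊ c ≟ c' ⌋ _) ⟩
    δ a a' * (δ b b' * (δ c c' * δ d d'))                      ∎
    where open ≡-Reasoning

  ==-sound : ∀ P Q → _==_ F P Q ≡ true → P ≡ Q
  ==-sound (mat a b c d) (mat a' b' c' d') e with a ≟ a' | b ≟ b' | c ≟ c' | d ≟ d'
  ... | yes refl | yes refl | yes refl | yes refl = refl
  ==-sound _ _ () | no _  | _     | _     | _
  ==-sound _ _ () | yes _ | no _  | _     | _
  ==-sound _ _ () | yes _ | yes _ | no _  | _
  ==-sound _ _ () | yes _ | yes _ | yes _ | no _

  ==-refl : ∀ P → _==_ F P P ≡ true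
  ==-refl (mat a b c d) = cong₂ _∧_ (self a) (cong₂ _∧_ (self b) (cong₂ _∧_ (self c) (self d)))
    where
    self : ∀ u → ⌊ u ≟ u ⌋ ≡ true
    self u with u ≟ u
    ... | yes _  = refl
    ... | no u≢u = ⊥-elim (u≢u refl)

  ==-iff : ∀ P Q P' Q' → (P ≡ Q → P' ≡ Q') → (P' ≡ Q' → P ≡ Q) → _==_ F P Q ≡ _==_ F P' Q'
  ==-iff P Q P' Q' to from with _==_ F P Q in e | _==_ F P' Q' in e'
  ... | true  | true  = refl
  ... | false | false = refl
  ... | true  | false = trans (sym (subst (λ Z → _==_ F P' Z ≡ true) (to (==-sound P Q e)) (==-refl P'))) e'
  ... | false | true  = sym (trans (sym (subst (λ Z → _==_ F P Z ≡ true) (from (==-sound P' Q' e')) (==-refl P))) e)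

  ∑-allMats : (G : Mat F → ℤ) →
    ∑ (allMats F) G ≡ ∑ elems λ a → ∑ elems λ b → ∑ elems λ c → ∑ elems λ d → G (mat a b c d)
  ∑-allMats G =
    trans (∑-concatMap _ elems G) (∑-cong elems λ a →
    trans (∑-concatMap _ elems G) (∑-cong elems λ b →
    trans (∑-concatMap _ elems G) (∑-cong elems λ c →
    ∑-map _ elems G)))

  ∑-SL₂-δ : ∀ B → det F B ≡ 𝟙 → (h : Mat F → ℤ) → ∑ (SL₂ F) (λ Y → ind F (_==_ F Y B) * h Y) ≡ h B
  ∑-SL₂-δ (mat a₀ b₀ c₀ d₀) det≡𝟙 h = begin
    ∑ (SL₂ F) (λ Y → ind F (_==_ F Y B) * h Y)                            ≡⟨ ∑-filter (λ Y → det F Y ≟ 𝟙) (allMats F) _ ⟩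
    ∑ (allMats F) (λ Y → inSL₂ Y * (ind F (_==_ F Y B) * h Y))            ≡⟨ ∑-allMats _ ⟩
    (∑ elems λ a → ∑ elems λ b → ∑ elems λ c → ∑ elems λ d →
       inSL₂ (mat a b c d) * (ind F (_==_ F (mat a b c d) B) * h (mat a b c d)))
      ≡⟨ ∑-cong elems (λ a → ∑-cong elems λ b → ∑-cong elems λ c → ∑-cong elems λ d → factor a b c d) ⟩
    (∑ elems λ a → ∑ elems λ b → ∑ elems λ c → ∑ elems λ d →
       δ d d₀ * (δ c c₀ * (δ b b₀ * (δ a a₀ * K (mat a b c d)))))
      ≡⟨ ∑-cong elems (λ a → ∑-cong elems λ b → ∑-cong elems λ c → ∑-δ d₀ _) ⟩
    (∑ elems λ a → ∑ elems λ b → ∑ elems λ c → δ c c₀ * (δ b b₀ * (δ a a₀ * K (mat a b c d₀))))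
      ≡⟨ ∑-cong elems (λ a → ∑-cong elems λ b → ∑-δ c₀ _) ⟩
    (∑ elems λ a → ∑ elems λ b → δ b b₀ * (δ a a₀ * K (mat a b c₀ d₀)))  ≡⟨ ∑-cong elems (λ a → ∑-δ b₀ _) ⟩
    (∑ elems λ a → δ a a₀ * K (mat a b₀ c₀ d₀))                          ≡⟨ ∑-δ a₀ _ ⟩
    K B                                                                  ≡⟨ K-B ⟩
    h B                                                                  ∎
    where
    open ≡-Reasoning
    B = mat a₀ b₀ c₀ d₀
    inSL₂ : Mat F → ℤ
    inSL₂ Y = [ does (det F Y ≟ 𝟙) ]
    K : Mat F → ℤ
    K Y = inSL₂ Y * h Y
    factor : ∀ a b c d → inSL₂ (mat a b c d) * (ind F (_==_ F (mat a b c d) B) * h (mat a b c d))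
                       ≡ δ d d₀ * (δ c c₀ * (δ b b₀ * (δ a a₀ * K (mat a b c d))))
    factor a b c d = trans (cong (λ t → inSL₂ (mat a b c d) * (t * h (mat a b c d))) (==-δ a b c d a₀ b₀ c₀ d₀))
                           (reorder (inSL₂ (mat a b c d)) (δ a a₀) (δ b b₀) (δ c c₀) (δ d d₀) (h (mat a b c d)))
      where
      reorder : ∀ s p q r t u → s * ((p * (q * (r * t))) * u) ≡ t * (r * (q * (p * (s * u))))
      reorder = solve-∀
    K-B : K B ≡ h B
    K-B with det F B ≟ 𝟙
    ... | yes _   = ℤP.*-identityˡ (h B)
    ... | no det≢ = ⊥-elim (det≢ det≡𝟙)

module Convolution (F : FiniteField) (M : Subgroup F) where
  open FiniteField F
  open Subgroup M
  open FiniteSums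
  open Matrices F

  Mem-elemsM : ∀ {μ} → μ ∈ elemsM → Mem μ
  Mem-elemsM μ∈ = proj₂ (∈-filter⁻ Mem? {xs = elems} μ∈)

  S⋆ : (f : GroupRing F) (A : Mat F) → det F A ≡ 𝟙 →
    _⋆_ F (S F M) f A ≡ ∑ elemsM (λ μ → ∑ elems (λ x → f (genInv x μ ⊠ A)))
  S⋆ f A det≡𝟙 = begin
    _⋆_ F (S F M) f A
      ≡⟨ sumList-concatMap _ (SL₂ F) ⟩
    ∑ (SL₂ F) (λ X → ∑ (SL₂ F) (λ Y → ind F (_==_ F (X ⊠ Y) A) * (S F M X * f Y)))
      ≡⟨ ∑-cong (SL₂ F) (λ X → trans (∑-cong (SL₂ F) (λ Y → swap-front (ind F (_==_ F (X ⊠ Y) A)) (S F M X) (f Y)))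
                                     (∑-*ˡ (S F M X) (SL₂ F) _)) ⟩
    ∑ (SL₂ F) (λ X → S F M X * g X)
      ≡⟨ ∑-cong (SL₂ F) (λ X → cong (_* g X) (sumList-concatMap _ elemsM)) ⟩
    ∑ (SL₂ F) (λ X → ∑ elemsM (λ μ → ∑ elems (λ x → ind F (_==_ F X (gen F x μ)))) * g X)
      ≡⟨ ∑-cong (SL₂ F) (λ X → trans (sym (∑-*ʳ (g X) elemsM _)) (∑-cong elemsM (λ μ → sym (∑-*ʳ (g X) elems _)))) ⟩
    ∑ (SL₂ F) (λ X → ∑ elemsM (λ μ → ∑ elems (λ x → ind F (_==_ F X (gen F x μ)) * g X)))
      ≡⟨ trans (∑-swap (SL₂ F) elemsM _) (∑-cong elemsM (λ μ → ∑-swap (SL₂ F) elems _)) ⟩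
    ∑ elemsM (λ μ → ∑ elems (λ x → ∑ (SL₂ F) (λ X → ind F (_==_ F X (gen F x μ)) * g X)))
      ≡⟨ ∑-congIn elemsM (λ μ μ∈ → ∑-cong elems (λ x → sift μ (nonzero (Mem-elemsM μ∈)) x)) ⟩
    ∑ elemsM (λ μ → ∑ elems (λ x → f (genInv x μ ⊠ A)))
      ∎
    where
    open ≡-Reasoning
    swap-front : ∀ a b c → a * (b * c) ≡ b * (a * c)
    swap-front = solve-∀
    g : Mat F → ℤ
    g X = ∑ (SL₂ F) (λ Y → ind F (_==_ F (X ⊠ Y) A) * f Y)
    sift : ∀ μ → ¬ μ ≡ 𝟘 → ∀ x → ∑ (SL₂ F) (λ X → ind F (_==_ F X (gen F x μ)) * g X) ≡ f (genInv x μ ⊠ A)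
    sift μ μ≢𝟘 x = begin
      ∑ (SL₂ F) (λ X → ind F (_==_ F X (gen F x μ)) * g X)         ≡⟨ ∑-SL₂-δ (gen F x μ) det-gen g ⟩
      g (gen F x μ)                                                ≡⟨ ∑-cong (SL₂ F) (λ Y → cong (λ t → ind F t * f Y)
                                                                        (==-iff _ _ _ _ (proj₁ (divide Y A)) (proj₂ (divide Y A)))) ⟩
      ∑ (SL₂ F) (λ Y → ind F (_==_ F Y (genInv x μ ⊠ A)) * f Y)    ≡⟨ ∑-SL₂-δ (genInv x μ ⊠ A) (det-genInv⊠ A det≡𝟙) f ⟩
      f (genInv x μ ⊠ A)                                           ∎
      where
      open Generator {x} {μ} μ≢𝟘 renaming (gen⊠Y≡A⇔Y≡genInv⊠A to divide)

module Residues where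

  data Residue : Set where
    r0 r1 r2 r3 : Residue

  next : Residue → Residue
  next r0 = r1
  next r1 = r2
  next r2 = r3
  next r3 = r0

  res : ℕ → Residue
  res zero    = r0
  res (suc n) = next (res n)

  pick : {X : Set} → Residue → X → X → X → X → X
  pick r0 w x y z = w
  pick r1 w x y z = x
  pick r2 w x y z = y
  pick r3 w x y z = z

  next⁴ : ∀ r → next (next (next (next r))) ≡ r
  next⁴ r0 = refl
  next⁴ r1 = refl
  next⁴ r2 = refl
  next⁴ r3 = refl

  sel4-pick : ∀ {X : Set} n (w x y z : X) → sel4 n w x y z ≡ pick (res n) w x y z
  sel4-pick zero                      w x y z = refl
  sel4-pick (suc zero)                w x y z = refl
  sel4-pick (suc (suc zero))          w x y z = refl
  sel4-pick (suc (suc (suc zero)))    w x y z = refl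
  sel4-pick (suc (suc (suc (suc n)))) w x y z =
    trans (sel4-pick n w x y z) (cong (λ r → pick r w x y z) (sym (next⁴ (res n))))

  sel2-pick : ∀ {X : Set} n (e o : X) → sel2 n e o ≡ pick (res n) e o e o
  sel2-pick zero                      e o = refl
  sel2-pick (suc zero)                e o = refl
  sel2-pick (suc (suc zero))          e o = refl
  sel2-pick (suc (suc (suc zero)))    e o = refl
  sel2-pick (suc (suc (suc (suc n)))) e o =
    trans (sel2-pick n e o) (cong (λ r → pick r e o e o) (sym (next⁴ (res n))))

  ∑-pick : ∀ {X : Set} r (L : List X) (f g h k : X → ℤ) →
    FiniteSums.∑ L (λ y → pick r (f y) (g y) (h y) (k y))
      ≡ pick r (FiniteSums.∑ L f) (FiniteSums.∑ L g) (FiniteSums.∑ L h) (FiniteSums.∑ L k)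
  ∑-pick r0 L f g h k = refl
  ∑-pick r1 L f g h k = refl
  ∑-pick r2 L f g h k = refl
  ∑-pick r3 L f g h k = refl

  twice : ℕ → ℕ
  twice zero    = zero
  twice (suc k) = suc (suc (twice k))

  data Parity : ℕ → Set where
    even : ∀ k → Parity (twice k)
    odd  : ∀ k → Parity (suc (twice k))

  parity : ∀ n → Parity n
  parity zero = even zero
  parity (suc n) with parity n
  ... | even k = odd k
  ... | odd  k = even (suc k)

  data EvenResidue : Residue → Set where
    is-r0 : EvenResidue r0
    is-r2 : EvenResidue r2

  res-twice : ∀ k → EvenResidue (res (twice k))
  res-twice zero = is-r0
  res-twice (suc k) with res (twice k) | res-twice k
  ... | r0 | is-r0 = is-r2
  ... | r2 | is-r2 = is-r0

module Recurrences (q m : ℕ) where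
  open Residues

  B A G : ℕ → ℤ
  B = mβ q m
  A = mα q m
  G = mγ q m

  B₁ : B 1 ≡ + 0
  B₁ = ℤP.*-zeroʳ (+ (m ℕ.* 1))

  A₁ : A 1 ≡ + 0
  A₁ = ℤP.*-zeroʳ (+ (m ℕ.* 1))

  G₁ : G 1 ≡ + 1
  G₁ = cong (_+ + 1) A₁

  record OddStep (n : ℕ) : Set where
    field
      B-step : B (suc n) ≡ + m * (+ q * B n)
      A-step : A (suc n) ≡ + m * (A n + (+ q - + 1) * B n)
      G-step : G (suc n) ≡ + m * (G n + (+ q - + 1) * B n)

  record EvenStep (n : ℕ) : Set where
    field
      G-step : G (suc n) ≡ + m * (+ q * G n)
      A-step : A (suc n) ≡ + m * (+ q * A n)
      B-step : B (suc n) ≡ + m * (B n + (+ q - + 1) * A n + + m * (G n - A n))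

  Step : Residue → ℕ → Set
  Step r0 = EvenStep
  Step r1 = OddStep
  Step r2 = EvenStep
  Step r3 = OddStep

  ε-twice : ∀ k → ε (twice k) ≡ 1
  ε-twice zero    = refl
  ε-twice (suc k) = ε-twice k

  ε-suc-twice : ∀ k → ε (suc (twice k)) ≡ 0
  ε-suc-twice zero    = refl
  ε-suc-twice (suc k) = ε-suc-twice k

  kk-suc-twice : ∀ k → kk (suc (twice k)) ≡ k
  kk-suc-twice zero    = refl
  kk-suc-twice (suc k) = cong suc (kk-suc-twice k)

  kk-twice+2 : ∀ k → kk (suc (suc (twice k))) ≡ k
  kk-twice+2 zero    = refl
  kk-twice+2 (suc k) = cong suc (kk-twice+2 k)

  geom-closed : ∀ k → + (q ℕ.^ k) ≡ + 1 + (+ q - + 1) * + geom q k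
  geom-closed zero    = sym (cong (_+_ (+ 1)) (ℤP.*-zeroʳ (+ q - + 1)))
  geom-closed (suc k) = begin
    + (q ℕ.^ suc k)                                 ≡⟨ ℤP.pos-* q (q ℕ.^ k) ⟩
    + q * + (q ℕ.^ k)                               ≡⟨ cong (_*_ (+ q)) (geom-closed k) ⟩
    + q * (+ 1 + (+ q - + 1) * + geom q k)          ≡⟨ expand (+ q) (+ geom q k) ⟩
    + 1 + (+ q - + 1) * (+ 1 + + q * + geom q k)    ≡⟨ cong (λ z → + 1 + (+ q - + 1) * (+ 1 + z)) (sym (ℤP.pos-* q (geom q k))) ⟩
    + 1 + (+ q - + 1) * + geom q (suc k)            ∎
    where
    open ≡-Reasoning
    expand : ∀ q g → q * (+ 1 + (q - + 1) * g) ≡ + 1 + (q - + 1) * (+ 1 + q * g)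
    expand = solve-∀

  B-at : ∀ t {e k} → ε (suc t) ≡ e → kk (suc t) ≡ k →
    B (suc t) ≡ (+ m * + (m ℕ.^ t)) * (+ (q ℕ.^ e) * + geom (q ℕ.^ 2) k)
  B-at t refl refl = cong₂ _*_ (ℤP.pos-* m (m ℕ.^ t)) (ℤP.pos-* (q ℕ.^ ε (suc t)) (geom (q ℕ.^ 2) (kk (suc t))))

  A-at : ∀ t {e k} → ε (suc t) ≡ e → kk (suc t) ≡ k →
    A (suc t) ≡ (+ m * + (m ℕ.^ t)) * (+ (q ℕ.^ e) * + geom (q ℕ.^ 2) k - + geom q k)
  A-at t refl refl = cong₂ _*_ (ℤP.pos-* m (m ℕ.^ t))
    (cong (_- + geom q (kk (suc t))) (ℤP.pos-* (q ℕ.^ ε (suc t)) (geom (q ℕ.^ 2) (kk (suc t)))))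

  G-at : ∀ t {e k} → ε (suc t) ≡ e → kk (suc t) ≡ k →
    G (suc t) ≡ (+ m * + (m ℕ.^ t)) * (+ (q ℕ.^ e) * + geom (q ℕ.^ 2) k - + geom q k) + + (m ℕ.^ t) * + (q ℕ.^ k)
  G-at t ε≡ refl = cong (_+ + (m ℕ.^ t) * + (q ℕ.^ kk (suc t))) (A-at t ε≡ refl)

  private
    mˢ : ∀ t → + (m ℕ.^ suc t) ≡ + m * + (m ℕ.^ t)
    mˢ t = ℤP.pos-* m (m ℕ.^ t)

    q¹ : + (q ℕ.^ 1) ≡ + q
    q¹ = cong +_ (ℕP.*-identityʳ q)


  -- n = 2k + 1 odd: the exponent of q goes from 0 to 1, and k(n+1) = k(n)
  oddStep : ∀ k → OddStep (suc (twice k))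
  oddStep k = record { B-step = B-step ; A-step = A-step ; G-step = G-step }
    where
    p = + (m ℕ.^ twice k)
    g₁ = + geom q k
    g₂ = + geom (q ℕ.^ 2) k
    K = + (q ℕ.^ k)
    Bₙ : B (suc (twice k)) ≡ (+ m * p) * (+ 1 * g₂)
    Bₙ = B-at (twice k) (ε-suc-twice k) (kk-suc-twice k)
    Aₙ : A (suc (twice k)) ≡ (+ m * p) * (+ 1 * g₂ - g₁)
    Aₙ = A-at (twice k) (ε-suc-twice k) (kk-suc-twice k)
    Gₙ : G (suc (twice k)) ≡ (+ m * p) * (+ 1 * g₂ - g₁) + p * K
    Gₙ = G-at (twice k) (ε-suc-twice k) (kk-suc-twice k)
    Bₙ₊₁ : B (suc (suc (twice k))) ≡ (+ m * (+ m * p)) * (+ q * g₂)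
    Bₙ₊₁ = trans (B-at (suc (twice k)) (ε-twice (suc k)) (kk-twice+2 k))
                 (cong₂ (λ u v → (+ m * u) * (v * g₂)) (mˢ (twice k)) q¹)
    Aₙ₊₁ : A (suc (suc (twice k))) ≡ (+ m * (+ m * p)) * (+ q * g₂ - g₁)
    Aₙ₊₁ = trans (A-at (suc (twice k)) (ε-twice (suc k)) (kk-twice+2 k))
                 (cong₂ (λ u v → (+ m * u) * (v * g₂ - g₁)) (mˢ (twice k)) q¹)
    Gₙ₊₁ : G (suc (suc (twice k))) ≡ (+ m * (+ m * p)) * (+ q * g₂ - g₁) + (+ m * p) * K
    Gₙ₊₁ = trans (G-at (suc (twice k)) (ε-twice (suc k)) (kk-twice+2 k))
                 (cong₂ (λ u v → (+ m * u) * (v * g₂ - g₁) + u * K) (mˢ (twice k)) q¹)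

    B-step : B (suc (suc (twice k))) ≡ + m * (+ q * B (suc (twice k)))
    B-step = trans Bₙ₊₁ (trans (identity (+ m) (+ q) p g₂) (cong (λ b → + m * (+ q * b)) (sym Bₙ)))
      where
      identity : ∀ m q p g₂ → (m * (m * p)) * (q * g₂) ≡ m * (q * ((m * p) * (+ 1 * g₂)))
      identity = solve-∀
    A-step : A (suc (suc (twice k))) ≡ + m * (A (suc (twice k)) + (+ q - + 1) * B (suc (twice k)))
    A-step = trans Aₙ₊₁ (trans (identity (+ m) (+ q) p g₁ g₂)
               (cong₂ (λ a b → + m * (a + (+ q - + 1) * b)) (sym Aₙ) (sym Bₙ)))
      where
      identity : ∀ m q p g₁ g₂ → (m * (m * p)) * (q * g₂ - g₁) ≡ m * ((m * p) * (+ 1 * g₂ - g₁) + (q - + 1) * ((m * p) * (+ 1 * g₂)))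
      identity = solve-∀
    G-step : G (suc (suc (twice k))) ≡ + m * (G (suc (twice k)) + (+ q - + 1) * B (suc (twice k)))
    G-step = trans Gₙ₊₁ (trans (identity (+ m) (+ q) p g₁ g₂ K)
               (cong₂ (λ g b → + m * (g + (+ q - + 1) * b)) (sym Gₙ) (sym Bₙ)))
      where
      identity : ∀ m q p g₁ g₂ K → (m * (m * p)) * (q * g₂ - g₁) + (m * p) * K
                 ≡ m * ((m * p) * (+ 1 * g₂ - g₁) + p * K + (q - + 1) * ((m * p) * (+ 1 * g₂)))
      identity = solve-∀

  -- n = 2k + 2 even: the exponent of q goes from 1 to 0, and k(n+1) = k(n) + 1
  evenStep : ∀ k → EvenStep (suc (suc (twice k)))
  evenStep k = record { G-step = G-step ; A-step = A-step ; B-step = B-step }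
    where
    p = + (m ℕ.^ suc (twice k))
    g₁ = + geom q k
    g₂ = + geom (q ℕ.^ 2) k
    K = + (q ℕ.^ k)
    Bₙ : B (suc (suc (twice k))) ≡ (+ m * p) * (+ q * g₂)
    Bₙ = trans (B-at (suc (twice k)) (ε-twice (suc k)) (kk-twice+2 k)) (cong (λ v → (+ m * p) * (v * g₂)) q¹)
    Aₙ : A (suc (suc (twice k))) ≡ (+ m * p) * (+ q * g₂ - g₁)
    Aₙ = trans (A-at (suc (twice k)) (ε-twice (suc k)) (kk-twice+2 k)) (cong (λ v → (+ m * p) * (v * g₂ - g₁)) q¹)
    Gₙ : G (suc (suc (twice k))) ≡ (+ m * p) * (+ q * g₂ - g₁) + p * K
    Gₙ = trans (G-at (suc (twice k)) (ε-twice (suc k)) (kk-twice+2 k)) (cong (λ v → (+ m * p) * (v * g₂ - g₁) + p * K) q¹)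
    g₁ˢ : + geom q (suc k) ≡ + 1 + + q * g₁
    g₁ˢ = trans (ℤP.pos-+ 1 _) (cong (_+_ (+ 1)) (ℤP.pos-* q (geom q k)))
    g₂ˢ : + geom (q ℕ.^ 2) (suc k) ≡ + 1 + (+ q * + q) * g₂
    g₂ˢ = trans (ℤP.pos-+ 1 _) (cong (_+_ (+ 1)) (trans (ℤP.pos-* (q ℕ.^ 2) (geom (q ℕ.^ 2) k))
            (cong (_* g₂) (trans (cong (λ z → + (q ℕ.* z)) (ℕP.*-identityʳ q)) (ℤP.pos-* q q)))))
    Kˢ : + (q ℕ.^ suc k) ≡ + q * K
    Kˢ = ℤP.pos-* q (q ℕ.^ k)
    Bₙ₊₁ : B (suc (suc (suc (twice k)))) ≡ (+ m * (+ m * p)) * (+ 1 * (+ 1 + (+ q * + q) * g₂))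
    Bₙ₊₁ = trans (B-at (suc (suc (twice k))) (ε-suc-twice (suc k)) (kk-suc-twice (suc k)))
                 (cong₂ (λ u v → (+ m * u) * (+ 1 * v)) (mˢ (suc (twice k))) g₂ˢ)
    Aₙ₊₁ : A (suc (suc (suc (twice k)))) ≡ (+ m * (+ m * p)) * (+ 1 * (+ 1 + (+ q * + q) * g₂) - (+ 1 + + q * g₁))
    Aₙ₊₁ = trans (A-at (suc (suc (twice k))) (ε-suc-twice (suc k)) (kk-suc-twice (suc k)))
                 (cong₃ (λ u v w → (+ m * u) * (+ 1 * v - w)) (mˢ (suc (twice k))) g₂ˢ g₁ˢ)
    Gₙ₊₁ : G (suc (suc (suc (twice k)))) ≡ (+ m * (+ m * p)) * (+ 1 * (+ 1 + (+ q * + q) * g₂) - (+ 1 + + q * g₁)) + (+ m * p) * (+ q * K)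
    Gₙ₊₁ = trans (G-at (suc (suc (twice k))) (ε-suc-twice (suc k)) (kk-suc-twice (suc k)))
                 (cong₄ (λ u v w z → (+ m * u) * (+ 1 * v - w) + u * z) (mˢ (suc (twice k))) g₂ˢ g₁ˢ Kˢ)

    G-step : G (suc (suc (suc (twice k)))) ≡ + m * (+ q * G (suc (suc (twice k))))
    G-step = trans Gₙ₊₁ (trans (identity (+ m) (+ q) p g₁ g₂ K) (cong (λ g → + m * (+ q * g)) (sym Gₙ)))
      where
      identity : ∀ m q p g₁ g₂ K → (m * (m * p)) * (+ 1 * (+ 1 + (q * q) * g₂) - (+ 1 + q * g₁)) + (m * p) * (q * K)
                 ≡ m * (q * ((m * p) * (q * g₂ - g₁) + p * K))
      identity = solve-∀
    A-step : A (suc (suc (suc (twice k)))) ≡ + m * (+ q * A (suc (suc (twice k))))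
    A-step = trans Aₙ₊₁ (trans (identity (+ m) (+ q) p g₁ g₂) (cong (λ a → + m * (+ q * a)) (sym Aₙ)))
      where
      identity : ∀ m q p g₁ g₂ → (m * (m * p)) * (+ 1 * (+ 1 + (q * q) * g₂) - (+ 1 + q * g₁))
                 ≡ m * (q * ((m * p) * (q * g₂ - g₁)))
      identity = solve-∀
    -- this one uses  q^k = 1 + (q - 1)(1 + … + q^{k-1})
    B-step : B (suc (suc (suc (twice k)))) ≡ + m * (B (suc (suc (twice k))) + (+ q - + 1) * A (suc (suc (twice k)))
                                                 + + m * (G (suc (suc (twice k))) - A (suc (suc (twice k)))))
    B-step = trans Bₙ₊₁ (trans (identity (+ m) (+ q) p g₁ g₂)
               (cong₃ (λ b a g → + m * (b + (+ q - + 1) * a + + m * (g - a))) (sym Bₙ) (sym Aₙ)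
                      (sym (trans Gₙ (cong (λ z → (+ m * p) * (+ q * g₂ - g₁) + p * z) (geom-closed k))))))
      where
      identity : ∀ m q p g₁ g₂ → (m * (m * p)) * (+ 1 * (+ 1 + (q * q) * g₂))
                 ≡ m * ((m * p) * (q * g₂) + (q - + 1) * ((m * p) * (q * g₂ - g₁))
                        + m * ((m * p) * (q * g₂ - g₁) + p * (+ 1 + (q - + 1) * g₁) - (m * p) * (q * g₂ - g₁)))
      identity = solve-∀

  step : ∀ t → Step (res (suc t)) (suc t)
  step t with parity t
  ... | even k with res (twice k) | res-twice k
  ...   | r0 | is-r0 = oddStep k
  ...   | r2 | is-r2 = oddStep k
  step t | odd k with res (twice k) | res-twice k
  ...   | r0 | is-r0 = evenStep k
  ...   | r2 | is-r2 = evenStep k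

-- Writing r = n mod 4 and χ_n(e) = γ_n if e ∈ M, α_n otherwise,
-- the table defining κ_n collapses, whether or not -1 ∈ M, to
--   κ_n(b,0) = (β, χ(b), β, χ(-b))_r ,   κ_n(b,d) = (χ(d), β, χ(-d), β)_r  for d ≠ 0,
-- where (w,x,y,z)_r picks the entry of index r (all values scaled by m^n).
module ClosedForm (F : FiniteField) (M : Subgroup F) where
  open FiniteField F
  open Subgroup M
  open FieldFacts F
  open Members M
  open FiniteSums
  open Enumerated _≟_ elems elems-unique elems-complete
  open Residues
  open Recurrences q m

  χ : ℕ → Carrier → ℤ
  χ n e = if does (Mem? e) then G n else A n

  onRow : ℕ → Carrier → ℤ
  onRow n b = pick (res n) (B n) (χ n b) (B n) (χ n (⊝ b))

  offRow : ℕ → Carrier → ℤ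
  offRow n d = pick (res n) (χ n d) (B n) (χ n (⊝ d)) (B n)

  κ : ℕ → Carrier → Carrier → ℤ
  κ n b d with d ≟ 𝟘
  ... | yes _ = onRow n b
  ... | no  _ = offRow n d

  κ-zero : ∀ n b → κ n b 𝟘 ≡ onRow n b
  κ-zero n b with 𝟘 ≟ 𝟘
  ... | yes _   = refl
  ... | no 𝟘≢𝟘 = ⊥-elim (𝟘≢𝟘 refl)

  κ-nonzero : ∀ n b d → ¬ d ≡ 𝟘 → κ n b d ≡ offRow n d
  κ-nonzero n b d d≢𝟘 with d ≟ 𝟘
  ... | yes d≡𝟘 = ⊥-elim (d≢𝟘 d≡𝟘)
  ... | no  _   = refl

  χ-∈ : ∀ {n e} → Mem e → χ n e ≡ G n
  χ-∈ {n} {e} e∈M with Mem? e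
  ... | yes _   = refl
  ... | no  e∉M = ⊥-elim (e∉M e∈M)

  χ-∉ : ∀ {n e} → ¬ Mem e → χ n e ≡ A n
  χ-∉ {n} {e} e∉M with Mem? e
  ... | yes e∈M = ⊥-elim (e∉M e∈M)
  ... | no  _   = refl

  mκ≡κ : ∀ n b d → mκ F M n b d ≡ κ n b d
  mκ≡κ n b d with Mem? (⊝ 𝟙)
  ... | yes ⊝𝟙∈M with d ≟ 𝟘
  ...   | yes _ with Mem? b
  ...     | yes b∈M = trans (sel2-pick n _ _) (cong (pick (res n) _ _ _) (sym (χ-∈ {n} (Mem-⊝ ⊝𝟙∈M b∈M))))
  ...     | no  b∉M = trans (sel2-pick n _ _) (cong (pick (res n) _ _ _) (sym (χ-∉ {n} (⊝∉M ⊝𝟙∈M b∉M))))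
  mκ≡κ n b d | yes ⊝𝟙∈M | no _ with Mem? d
  ...     | yes d∈M = trans (sel2-pick n _ _) (cong (λ z → pick (res n) _ _ z _) (sym (χ-∈ {n} (Mem-⊝ ⊝𝟙∈M d∈M))))
  ...     | no  d∉M = trans (sel2-pick n _ _) (cong (λ z → pick (res n) _ _ z _) (sym (χ-∉ {n} (⊝∉M ⊝𝟙∈M d∉M))))
  mκ≡κ n b d | no ⊝𝟙∉M with d ≟ 𝟘
  ...   | yes _ with Mem? b | Mem? (⊝ b)
  ...     | yes b∈M | yes ⊝b∈M = ⊥-elim (⊝𝟙∉M (Mem-both⇒⊝𝟙 b∈M ⊝b∈M))
  ...     | yes _   | no  _    = sel4-pick n _ _ _ _
  ...     | no  _   | yes _    = sel4-pick n _ _ _ _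
  ...     | no  _   | no  _    = sel4-pick n _ _ _ _
  mκ≡κ n b d | no ⊝𝟙∉M | no _ with Mem? d | Mem? (⊝ d)
  ...     | yes d∈M | yes ⊝d∈M = ⊥-elim (⊝𝟙∉M (Mem-both⇒⊝𝟙 d∈M ⊝d∈M))
  ...     | yes _   | no  _    = sel4-pick n _ _ _ _
  ...     | no  _   | yes _    = sel4-pick n _ _ _ _
  ...     | no  _   | no  _    = sel4-pick n _ _ _ _

  χ-scale : ∀ n {μ} → Mem μ → ∀ e → χ n (μ · e) ≡ χ n e
  χ-scale n {μ} μ∈M e with Mem? (μ · e) | Mem? e
  ... | yes _    | yes _   = refl
  ... | no  _    | no  _   = refl
  ... | yes μe∈M | no e∉M  = ⊥-elim (e∉M (Mem-cancelˡ μ∈M μe∈M))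
  ... | no μe∉M  | yes e∈M = ⊥-elim (μe∉M (mul μ∈M e∈M))

  χ-as-indicator : ∀ n e → χ n e ≡ A n + [ does (Mem? e) ] * (G n - A n)
  χ-as-indicator n e with Mem? e
  ... | yes _ = identity (G n) (A n)
    where
    identity : ∀ g a → g ≡ a + + 1 * (g - a)
    identity = solve-∀
  ... | no  _ = sym (ℤP.+-identityʳ (A n))

  ∑-χ : ∀ n → ∑ elems (χ n) ≡ + q * A n + + m * (G n - A n)
  ∑-χ n = begin
    ∑ elems (χ n)                                                   ≡⟨ ∑-cong elems (χ-as-indicator n) ⟩
    ∑ elems (λ y → A n + [ does (Mem? y) ] * (G n - A n))           ≡⟨ ∑-+ elems _ _ ⟩
    ∑ elems (λ _ → A n) + ∑ elems (λ y → [ does (Mem? y) ] * (G n - A n))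
      ≡⟨ cong₂ _+_ (∑-const elems (A n)) (∑-*ʳ (G n - A n) elems _) ⟩
    + q * A n + ∑ elems (λ y → [ does (Mem? y) ]) * (G n - A n)   ≡⟨ cong (λ c → + q * A n + c * (G n - A n)) (count-filter Mem? elems) ⟩
    + q * A n + + m * (G n - A n)                                   ∎
    where open ≡-Reasoning

  ∑-χ⊝ : ∀ n → ∑ elems (λ y → χ n (⊝ y)) ≡ + q * A n + + m * (G n - A n)
  ∑-χ⊝ n = trans (∑-reindex ⊝_ ⊝_ ⊝⊝ ⊝⊝ (χ n)) (∑-χ n)

  ∑-offRow : ∀ n → ∑ elems (offRow n) ≡ pick (res n) (+ q * A n + + m * (G n - A n)) (+ q * B n)
                                                      (+ q * A n + + m * (G n - A n)) (+ q * B n)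
  ∑-offRow n = trans (∑-pick (res n) elems _ _ _ _)
                     (cong₃ (λ u v w → pick (res n) u v w v) (∑-χ n) (∑-const elems (B n)) (∑-χ⊝ n))

  -- 0 ∉ M, so offRow at 0 takes the value α where it is not β
  offRow-𝟘 : ∀ n → offRow n 𝟘 ≡ pick (res n) (A n) (B n) (A n) (B n)
  offRow-𝟘 n = cong₂ (λ u v → pick (res n) u (B n) v (B n))
                     (χ-∉ {n} (λ 𝟘∈M → nonzero 𝟘∈M refl)) (χ-∉ {n} (λ ⊝𝟘∈M → nonzero ⊝𝟘∈M ⊝𝟘))

  κ-column : ∀ n e y → κ n e y ≡ δ y 𝟘 * (onRow n e - offRow n 𝟘) + offRow n y
  κ-column n e y with y ≟ 𝟘
  ... | yes refl = at-𝟘 (onRow n e) (offRow n 𝟘)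
    where
    at-𝟘 : ∀ z y → z ≡ + 1 * (z - y) + y
    at-𝟘 = solve-∀
  ... | no  _    = sym (ℤP.+-identityˡ (offRow n y))

  colB : ℕ → ℤ
  colB n = B n + (+ q - + 1) * A n + + m * (G n - A n)

  colχ : ℕ → Carrier → ℤ
  colχ n e = χ n e + (+ q - + 1) * B n

  private
    collect : ∀ r (q m b a g x x' : ℤ) →
      (pick r b x b x' - pick r a b a b) + pick r (q * a + m * (g - a)) (q * b) (q * a + m * (g - a)) (q * b)
        ≡ pick r (b + (q - + 1) * a + m * (g - a)) (x + (q - + 1) * b) (b + (q - + 1) * a + m * (g - a)) (x' + (q - + 1) * b)
    collect r0 q m b a g x x' = even-identity b a g q m
      where
      even-identity : ∀ b a g q m → (b - a) + (q * a + m * (g - a)) ≡ b + (q - + 1) * a + m * (g - a)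
      even-identity = solve-∀
    collect r1 q m b a g x x' = odd-identity x b q
      where
      odd-identity : ∀ x b q → (x - b) + q * b ≡ x + (q - + 1) * b
      odd-identity = solve-∀
    collect r2 q m b a g x x' = collect r0 q m b a g x x'
    collect r3 q m b a g x x' = collect r1 q m b a g x' x

  ∑-κ : ∀ n e → ∑ elems (κ n e) ≡ pick (res n) (colB n) (colχ n e) (colB n) (colχ n (⊝ e))
  ∑-κ n e = begin
    ∑ elems (κ n e)                                                      ≡⟨ ∑-cong elems (κ-column n e) ⟩
    ∑ elems (λ y → δ y 𝟘 * (onRow n e - offRow n 𝟘) + offRow n y)       ≡⟨ ∑-+ elems _ (offRow n) ⟩
    ∑ elems (λ y → δ y 𝟘 * (onRow n e - offRow n 𝟘)) + ∑ elems (offRow n)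
      ≡⟨ cong₂ _+_ (trans (∑-δ 𝟘 (λ _ → onRow n e - offRow n 𝟘)) (cong (onRow n e -_) (offRow-𝟘 n))) (∑-offRow n) ⟩
    (onRow n e - pick (res n) (A n) (B n) (A n) (B n))
      + pick (res n) (+ q * A n + + m * (G n - A n)) (+ q * B n) (+ q * A n + + m * (G n - A n)) (+ q * B n)
      ≡⟨ collect (res n) (+ q) (+ m) (B n) (A n) (G n) (χ n e) (χ n (⊝ e)) ⟩
    pick (res n) (colB n) (colχ n e) (colB n) (colχ n (⊝ e))            ∎
    where open ≡-Reasoning

  χ-even-step : ∀ {n} → EvenStep n → ∀ e → χ (suc n) e ≡ + m * (+ q * χ n e)
  χ-even-step {n} s e with Mem? e
  ... | yes _ = EvenStep.G-step s
  ... | no  _ = EvenStep.A-step s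

  χ-odd-step : ∀ {n} → OddStep n → ∀ e → χ (suc n) e ≡ + m * colχ n e
  χ-odd-step {n} s e with Mem? e
  ... | yes _ = OddStep.G-step s
  ... | no  _ = OddStep.A-step s

  advance-d≡𝟘 : ∀ r n → Step r n → ∀ b →
    pick (next r) (B (suc n)) (χ (suc n) b) (B (suc n)) (χ (suc n) (⊝ b))
      ≡ + m * (+ q * pick r (χ n b) (B n) (χ n (⊝ b)) (B n))
  advance-d≡𝟘 r0 n s b = χ-even-step s b
  advance-d≡𝟘 r1 n s b = OddStep.B-step s
  advance-d≡𝟘 r2 n s b = χ-even-step s (⊝ b)
  advance-d≡𝟘 r3 n s b = OddStep.B-step s

  advance-d≢𝟘 : ∀ r n → Step r n → ∀ d →
    pick (next r) (χ (suc n) d) (B (suc n)) (χ (suc n) (⊝ d)) (B (suc n))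
      ≡ + m * pick r (colB n) (colχ n (⊝ d)) (colB n) (colχ n d)
  advance-d≢𝟘 r0 n s d = EvenStep.B-step s
  advance-d≢𝟘 r1 n s d = χ-odd-step s (⊝ d)
  advance-d≢𝟘 r2 n s d = EvenStep.B-step s
  advance-d≢𝟘 r3 n s d = χ-odd-step s d

module PowersOfS (F : FiniteField) (M : Subgroup F) where
  open FiniteField F
  open Subgroup M
  open FieldSolver F using (solve; _:=_; _:+_; _:*_; :-_; con)
  open FieldFacts F
  open FiniteSums
  open Enumerated _≟_ elems elems-unique elems-complete
  open Matrices F
  open Convolution F M
  open Residues
  open Recurrences q m
  open ClosedForm F M

  -- S(A) for A ∈ SL₂(F_q): the generator g(x,μ) equals A iff (x,μ,-1/μ,0) = (a,b,c,d)
  S-on-SL₂ : ∀ a b c d → det F (mat a b c d) ≡ 𝟙 →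
    (_^GR_ F (S F M) 1) (mat a b c d) ≡ ∑ elemsM (λ μ → δ b μ * (δ c (⊝ (μ ⁻¹)) * δ d 𝟘))
  S-on-SL₂ a b c d det≡𝟙 = begin
    (_^GR_ F (S F M) 1) X                                        ≡⟨ S⋆ (unitGR F) X det≡𝟙 ⟩
    ∑ elemsM (λ μ → ∑ elems (λ x → unitGR F (genInv x μ ⊠ X)))  ≡⟨ ∑-congIn elemsM (λ μ μ∈ → ∑-cong elems (λ x →
                                                                      is-generator μ (nonzero (Mem-elemsM μ∈)) x)) ⟩
    ∑ elemsM (λ μ → ∑ elems (λ x → δ x a * indicator μ))        ≡⟨ ∑-cong elemsM (λ μ → ∑-δ a (λ _ → indicator μ)) ⟩
    ∑ elemsM indicator                                           ∎
    where
    open ≡-Reasoning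
    X = mat a b c d
    indicator : Carrier → ℤ
    indicator μ = δ b μ * (δ c (⊝ (μ ⁻¹)) * δ d 𝟘)
    is-generator : ∀ μ → ¬ μ ≡ 𝟘 → ∀ x → unitGR F (genInv x μ ⊠ X) ≡ δ x a * indicator μ
    is-generator μ μ≢𝟘 x = begin
      ind F (_==_ F (genInv x μ ⊠ X) (idMat F))  ≡⟨ cong (ind F) (==-iff _ _ _ _ (proj₁ (genInv⊠A≡I⇔A≡gen X)) (proj₂ (genInv⊠A≡I⇔A≡gen X))) ⟩
      ind F (_==_ F X (gen F x μ))               ≡⟨ ==-δ a b c d x μ (⊝ (μ ⁻¹)) 𝟘 ⟩
      δ a x * indicator μ                        ≡⟨ cong (_* indicator μ) (δ-sym a x) ⟩
      δ x a * indicator μ                        ∎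
      where open Generator {x} {μ} μ≢𝟘

  -- … which is κ_1: zero off the row d = 0, and [b ∈ M] on it (where c = -1/b)
  S-is-κ₁ : ∀ a b c d → Dec (d ≡ 𝟘) → det F (mat a b c d) ≡ 𝟙 →
    ∑ elemsM (λ μ → δ b μ * (δ c (⊝ (μ ⁻¹)) * δ d 𝟘)) ≡ κ 1 b d
  S-is-κ₁ a b c d (no d≢𝟘) _ = begin
    ∑ elemsM (λ μ → δ b μ * (δ c (⊝ (μ ⁻¹)) * δ d 𝟘))   ≡⟨ ∑-cong elemsM (λ μ → cong (λ t → δ b μ * (δ c (⊝ (μ ⁻¹)) * t)) (δ-≢ d≢𝟘)) ⟩
    ∑ elemsM (λ μ → δ b μ * (δ c (⊝ (μ ⁻¹)) * + 0))     ≡⟨ ∑-cong elemsM (λ μ → vanish (δ b μ) (δ c (⊝ (μ ⁻¹)))) ⟩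
    ∑ elemsM (λ _ → + 0)                                 ≡⟨ trans (∑-const elemsM (+ 0)) (ℤP.*-zeroʳ (+ m)) ⟩
    + 0                                                  ≡⟨ sym (trans (κ-nonzero 1 b d d≢𝟘) B₁) ⟩
    κ 1 b d                                              ∎
    where
    open ≡-Reasoning
    vanish : ∀ u v → u * (v * + 0) ≡ + 0
    vanish = solve-∀
  S-is-κ₁ a b c _ (yes refl) det≡𝟙 = begin
    ∑ elemsM (λ μ → δ b μ * (δ c (⊝ (μ ⁻¹)) * δ 𝟘 𝟘))   ≡⟨ ∑-cong elemsM (λ μ → cong (λ t → δ b μ * (δ c (⊝ (μ ⁻¹)) * t)) (δ-self 𝟘)) ⟩
    ∑ elemsM (λ μ → δ b μ * (δ c (⊝ (μ ⁻¹)) * + 1))     ≡⟨ ∑-filter Mem? elems _ ⟩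
    ∑ elems (λ μ → [ does (Mem? μ) ] * (δ b μ * (δ c (⊝ (μ ⁻¹)) * + 1)))
      ≡⟨ ∑-cong elems (λ μ → trans (cong (λ t → [ does (Mem? μ) ] * (t * (δ c (⊝ (μ ⁻¹)) * + 1))) (δ-sym b μ))
                                   (reorder [ does (Mem? μ) ] (δ μ b) (δ c (⊝ (μ ⁻¹))))) ⟩
    ∑ elems (λ μ → δ μ b * ([ does (Mem? μ) ] * δ c (⊝ (μ ⁻¹))))     ≡⟨ ∑-δ b _ ⟩
    [ does (Mem? b) ] * δ c (⊝ (b ⁻¹))                               ≡⟨ cong (λ z → [ does (Mem? b) ] * δ z (⊝ (b ⁻¹))) (det-d≡𝟘⇒c a b c det≡𝟙) ⟩
    [ does (Mem? b) ] * δ (⊝ (b ⁻¹)) (⊝ (b ⁻¹))                      ≡⟨ cong ([ does (Mem? b) ] *_) (δ-self _) ⟩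
    [ does (Mem? b) ] * + 1                                          ≡⟨ χ₁ ⟩
    χ 1 b                                                            ≡⟨ sym (κ-zero 1 b) ⟩
    κ 1 b 𝟘                                                          ∎
    where
    open ≡-Reasoning
    reorder : ∀ i u v → i * (u * (v * + 1)) ≡ u * (i * v)
    reorder = solve-∀
    χ₁ : [ does (Mem? b) ] * + 1 ≡ χ 1 b
    χ₁ with Mem? b
    ... | yes _ = sym G₁
    ... | no  _ = sym A₁

  -- One application of S to the closed form at n gives the closed form at n + 1.
  -- For d = 0 every summand equals κ_n(0, b/μ) = κ_n(0, b).
  step-d≡𝟘 : ∀ n → Step (res n) n → ∀ a b c → det F (mat a b c 𝟘) ≡ 𝟙 →
    ∑ elemsM (λ μ → ∑ elems (λ x → κ n (𝟘 · b ⊕ (⊝ μ) · 𝟘) (μ ⁻¹ · b ⊕ x · 𝟘))) ≡ κ (suc n) b 𝟘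
  step-d≡𝟘 n stepₙ a b c det≡𝟙 = begin
    ∑ elemsM (λ μ → ∑ elems (λ x → κ n (𝟘 · b ⊕ (⊝ μ) · 𝟘) (μ ⁻¹ · b ⊕ x · 𝟘)))
      ≡⟨ ∑-congIn elemsM (λ μ μ∈ → ∑-cong elems (entry μ (Mem-elemsM μ∈))) ⟩
    ∑ elemsM (λ _ → ∑ elems (λ _ → v))            ≡⟨ ∑-cong elemsM (λ _ → ∑-const elems v) ⟩
    ∑ elemsM (λ _ → + q * v)                      ≡⟨ ∑-const elemsM (+ q * v) ⟩
    + m * (+ q * v)                               ≡⟨ sym (advance-d≡𝟘 (res n) n stepₙ b) ⟩
    onRow (suc n) b                               ≡⟨ sym (κ-zero (suc n) b) ⟩
    κ (suc n) b 𝟘                                 ∎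
    where
    open ≡-Reasoning
    v = offRow n b
    entry : ∀ μ → Mem μ → ∀ x → κ n (𝟘 · b ⊕ (⊝ μ) · 𝟘) (μ ⁻¹ · b ⊕ x · 𝟘) ≡ v
    entry μ μ∈M x = begin
      κ n (𝟘 · b ⊕ (⊝ μ) · 𝟘) (μ ⁻¹ · b ⊕ x · 𝟘)
        ≡⟨ cong (κ n _) (solve 3 (λ i b x → i :* b :+ x :* con (+ 0) := i :* b) refl (μ ⁻¹) b x) ⟩
      κ n (𝟘 · b ⊕ (⊝ μ) · 𝟘) (μ ⁻¹ · b)
        ≡⟨ κ-nonzero n _ (μ ⁻¹ · b) (·-nonzero (μ ⁻¹) b (nonzero (inv μ∈M)) (det-d≡𝟘⇒b≢𝟘 a b c det≡𝟙)) ⟩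
      offRow n (μ ⁻¹ · b)
        ≡⟨ cong₂ (λ u w → pick (res n) u (B n) w (B n)) (χ-scale n (inv μ∈M) b)
                 (trans (cong (χ n) (solve 2 (λ i b → :- (i :* b) := i :* (:- b)) refl (μ ⁻¹) b)) (χ-scale n (inv μ∈M) (⊝ b))) ⟩
      v ∎

  -- For d ≠ 0, x ↦ b/μ + x d runs through F_q, so each μ contributes the full
  -- column sum at e = -μd; and χ(e), χ(-e) only depend on the coset of -d, d.
  step-d≢𝟘 : ∀ n → Step (res n) n → ∀ b d → ¬ d ≡ 𝟘 →
    ∑ elemsM (λ μ → ∑ elems (λ x → κ n (𝟘 · b ⊕ (⊝ μ) · d) (μ ⁻¹ · b ⊕ x · d))) ≡ κ (suc n) b d
  step-d≢𝟘 n stepₙ b d d≢𝟘 = begin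
    ∑ elemsM (λ μ → ∑ elems (λ x → κ n (𝟘 · b ⊕ (⊝ μ) · d) (μ ⁻¹ · b ⊕ x · d)))
      ≡⟨ ∑-congIn elemsM (λ μ μ∈ → column μ (Mem-elemsM μ∈)) ⟩
    ∑ elemsM (λ _ → w)                            ≡⟨ ∑-const elemsM w ⟩
    + m * w                                       ≡⟨ sym (advance-d≢𝟘 (res n) n stepₙ d) ⟩
    offRow (suc n) d                              ≡⟨ sym (κ-nonzero (suc n) b d d≢𝟘) ⟩
    κ (suc n) b d                                 ∎
    where
    open ≡-Reasoning
    w = pick (res n) (colB n) (colχ n (⊝ d)) (colB n) (colχ n d)
    column : ∀ μ → Mem μ → ∑ elems (λ x → κ n (𝟘 · b ⊕ (⊝ μ) · d) (μ ⁻¹ · b ⊕ x · d)) ≡ w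
    column μ μ∈M = begin
      ∑ elems (λ x → κ n e (μ ⁻¹ · b ⊕ x · d))
        ≡⟨ ∑-reindex _ _ (affine-inverseˡ (μ ⁻¹ · b) d d≢𝟘) (affine-inverseʳ (μ ⁻¹ · b) d d≢𝟘) (κ n e) ⟩
      ∑ elems (κ n e)                                           ≡⟨ ∑-κ n e ⟩
      pick (res n) (colB n) (colχ n e) (colB n) (colχ n (⊝ e))
        ≡⟨ cong₂ (λ u z → pick (res n) (colB n) (u + (+ q - + 1) * B n) (colB n) (z + (+ q - + 1) * B n)) χ-e χ-⊝e ⟩
      w ∎
      where
      e = 𝟘 · b ⊕ (⊝ μ) · d
      χ-e : χ n e ≡ χ n (⊝ d)
      χ-e = trans (cong (χ n) (solve 3 (λ b u d → con (+ 0) :* b :+ (:- u) :* d := u :* (:- d)) refl b μ d)) (χ-scale n μ∈M (⊝ d))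
      χ-⊝e : χ n (⊝ e) ≡ χ n d
      χ-⊝e = trans (cong (χ n) (solve 3 (λ b u d → :- (con (+ 0) :* b :+ (:- u) :* d) := u :* d) refl b μ d)) (χ-scale n μ∈M d)

  step-sum : ∀ n → Step (res n) n → ∀ a b c d → Dec (d ≡ 𝟘) → det F (mat a b c d) ≡ 𝟙 →
    ∑ elemsM (λ μ → ∑ elems (λ x → κ n (𝟘 · b ⊕ (⊝ μ) · d) (μ ⁻¹ · b ⊕ x · d))) ≡ κ (suc n) b d
  step-sum n stepₙ a b c _ (yes refl) det≡𝟙 = step-d≡𝟘 n stepₙ a b c det≡𝟙
  step-sum n stepₙ a b c d (no d≢𝟘)   _     = step-d≢𝟘 n stepₙ b d d≢𝟘

  power : ∀ t A → det F A ≡ 𝟙 → (_^GR_ F (S F M) (suc t)) A ≡ κ (suc t) (Mat.b A) (Mat.d A)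
  power zero    (mat a b c d) det≡𝟙 = trans (S-on-SL₂ a b c d det≡𝟙) (S-is-κ₁ a b c d (d ≟ 𝟘) det≡𝟙)
  power (suc t) X@(mat a b c d) det≡𝟙 = begin
    (_^GR_ F (S F M) (suc (suc t))) X                                         ≡⟨ S⋆ (_^GR_ F (S F M) (suc t)) X det≡𝟙 ⟩
    ∑ elemsM (λ μ → ∑ elems (λ x → (_^GR_ F (S F M) (suc t)) (genInv x μ ⊠ X)))
      ≡⟨ ∑-congIn elemsM (λ μ μ∈ → ∑-cong elems (λ x →
           power t (genInv x μ ⊠ X) (Generator.det-genInv⊠ {x} {μ} (nonzero (Mem-elemsM μ∈)) X det≡𝟙))) ⟩
    ∑ elemsM (λ μ → ∑ elems (λ x → κ (suc t) (𝟘 · b ⊕ (⊝ μ) · d) (μ ⁻¹ · b ⊕ x · d)))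
      ≡⟨ step-sum (suc t) (step t) a b c d (d ≟ 𝟘) det≡𝟙 ⟩
    κ (suc (suc t)) b d                                                       ∎
    where open ≡-Reasoning

theorem6 : (F : FiniteField) (M : Subgroup F) (n : ℕ) → n ≥ 1 →
    ∀ (A : Mat F) → det F A ≡ FiniteField.𝟙 F →
    (_^GR_ F (S F M) n) A ≡ mκ F M n (Mat.b A) (Mat.d A)
theorem6 F M (suc t) _ A det≡𝟙 =
  trans (PowersOfS.power F M t A det≡𝟙) (sym (ClosedForm.mκ≡κ F M (suc t) (Mat.b A) (Mat.d A)))
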